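{- Let $p,q,n$ be non-negative integers and let $\alpha_{(p,q;n)}$ be the number of domino tilings of the expanded $(p,q)$-Aztec diamond $AD_{(p,q;n)}$ of order $n$. Define matrices $A_k$ (of size $2^{k-1}\times 2^k$, for $k\ge 1$) by the seed matrices $$A_1=\begin{bmatrix}0&1\end{bmatrix},\qquad A_2=\begin{bmatrix}1&0&0&1\\0&1&0&0\end{bmatrix},$$ and, for $k\ge 3$, the block recurrence $$A_k=\begin{bmatrix}\begin{bmatrix}A_{k-2}&\mathbb{O}\\ \mathbb{O}&\mathbb{O}\end{bmatrix} & A_{k-1}\\ A_{k-1} & \mathbb{O}\end{bmatrix},$$ and define matrices $C_k$ (of size $2^k\times 2^k$, for $k\ge 0$) by $$C_0=\begin{bmatrix}1\end{bmatrix},\qquad C_1=\begin{bmatrix}0&1\\1&0\end{bmatrix},\qquad C_k=\begin{bmatrix}\begin{bmatrix}C_{k-2}&\mathbb{O}\\ \mathbb{O}&\mathbb{O}\end{bmatrix} & C_{k-1}\\ C_{k-1} & \mathbb{O}\end{bmatrix}\ (k\ge 2).$$ For $k=1,\dots,n$ let $$L_{p+2k}=\begin{bmatrix}\begin{bmatrix}A_{p+2k-2}&\mathbb{O}\\ \mathbb{O}&\mathbb{O}\end{bmatrix} & A_{p+2k-1}\end{bmatrix},$$ where, in the single case $p=0$, $k=1$ (where $A_0$ is undefined), the block $\begin{bmatrix}A_{0}&\mathbb{O}\\ \mathbb{O}&\mathbb{O}\end{bmatrix}$ is replaced by $\begin{bmatrix}1&0\end{bmatrix}$. Then $\alpha_{(p,q;n)}$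 equals the $(1,1)$-entry of the $2^p\times 2^p$ matrix $$\Big(\prod_{k=1}^n L_{p+2k}\Big)\cdot \big(C_{p+2n}\big)^q\cdot \Big(\prod_{k=1}^n L_{p+2k}\Big)^t ,$$ where $\prod_{k=1}^n L_{p+2k}=L_{p+2}L_{p+4}\cdots L_{p+2n}$.
   Context: $\mathbb{O}$ denotes a zero matrix of the appropriate size and $X^t$ the transpose of $X$. The expanded $(p,q)$-Aztec diamond of order $n$, $AD_{(p,q;n)}$, is the union of $2n(n+p+q+1)+pq$ unit lattice squares arranged as a bilaterally symmetric stack of $2n+q$ rows: for $j=1,\dots,2n+q$, row $j$ is $[-\ell_j/2,\ell_j/2]\times[j-1,j]$ subdivided into unit squares, where $\ell_j=p+2j$ for $1\le j\le n$, $\ell_j=p+2n$ for $n<j\le n+q$, and $\ell_j=p+2(2n+q+1-j)$ for $n+q<j\le 2n+q$ (so the row lengths are $p+2,p+4,\dots,p+2n,\dots,p+2n,\dots,p+4,p+2$). A domino tiling is a partition of the region into $1\times 2$ or $2\times 1$ rectangles each consisting of two of its unit squares. -}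

module Defs where

open import Data.Nat.Base using (ℕ; zero; suc; _+_; _*_; _∸_; _^_; _≡ᵇ_; _<ᵇ_; _≤ᵇ_)
open import Data.Bool.Base using (Bool; true; false; _∧_; if_then_else_)
open import Data.List.Base using (List; []; _∷_; _++_; map; length; filter; concatMap; upTo)
open import Data.Bool.ListAction using (and)
open import Data.Nat.ListAction using (sum)
open import Data.Product using (_×_; _,_)
open import Relation.Nullary.Decidable using (yes; no)
open import Data.Bool.Properties using (T?)

-- Matrices with natural-number entries, represented as functions
-- ℕ → ℕ → ℕ (row index, column index, both 0-based).  Every matrix
-- defined below is zero outside its nominal range, and sizes are
-- tracked explicitly (inner dimension of products).

Mat : Set
Mat = ℕ → ℕ → ℕ

ind : Bool → ℕ
ind true  = 1
ind false = 0

mul : ℕ → Mat → Mat → Mat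
mul d M N i j = sum (map (λ t → M i t * N t j) (upTo d))

idM : ℕ → Mat
idM d i j = ind ((i ≡ᵇ j) ∧ (i <ᵇ d))

tr : Mat → Mat
tr M i j = M j i

powM : ℕ → Mat → ℕ → Mat
powM d M zero    = idM d
powM d M (suc q) = mul d (powM d M q) M

-- A_k  (2^(k-1) × 2^k, k ≥ 1).  A 0 is not used (set to zero).

A : ℕ → Mat
A zero i j = 0
A (suc zero) i j = ind ((i ≡ᵇ 0) ∧ (j ≡ᵇ 1))
A (suc (suc zero)) i j =
  ind (((i ≡ᵇ 0) ∧ (j ≡ᵇ 0)) ∨' (((i ≡ᵇ 0) ∧ (j ≡ᵇ 3)) ∨' ((i ≡ᵇ 1) ∧ (j ≡ᵇ 1))))
  where
  _∨'_ : Bool → Bool → Bool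
  true  ∨' _ = true
  false ∨' b = b
-- K = k + 3;  half row count h = 2^(K-2), half column count w = 2^(K-1)
A (suc (suc (suc k))) i j =
  if i <ᵇ h
  then (if j <ᵇ w then A (suc k) i j else A (suc (suc k)) i (j ∸ w))
  else (if j <ᵇ w then A (suc (suc k)) (i ∸ h) j else 0)
  where
  h = 2 ^ (suc k)
  w = 2 ^ (suc (suc k))

C : ℕ → Mat
C zero i j = ind ((i ≡ᵇ 0) ∧ (j ≡ᵇ 0))
C (suc zero) i j = ind (((i ≡ᵇ 0) ∧ (j ≡ᵇ 1)) ∨' ((i ≡ᵇ 1) ∧ (j ≡ᵇ 0)))
  where
  _∨'_ : Bool → Bool → Bool
  true  ∨' _ = true
  false ∨' b = b
-- K = k + 2; half size h = 2^(K-1)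
C (suc (suc k)) i j =
  if i <ᵇ h
  then (if j <ᵇ h then C k i j else C (suc k) i (j ∸ h))
  else (if j <ᵇ h then C (suc k) (i ∸ h) j else 0)
  where
  h = 2 ^ (suc k)

-- Left block of L_{m'+2}:  [[A_{m'}, O],[O, O]]  (2^{m'} × 2^{m'+1}),
-- replaced by [1 0] when m' = 0.
Lleft : ℕ → Mat
Lleft zero i j = ind ((i ≡ᵇ 0) ∧ (j ≡ᵇ 0))
Lleft (suc m) i j = A (suc m) i j

-- L_{m'+2} = [ Lleft_{m'} | A_{m'+1} ]   (2^{m'} × 2^{m'+2})
L : ℕ → Mat
L zero i j = 0
L (suc zero) i j = 0
L (suc (suc m)) i j =
  if j <ᵇ w then Lleft m i j else A (suc m) i (j ∸ w)
  where
  w = 2 ^ (suc m)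

prodL : ℕ → ℕ → Mat
prodL p zero    = idM (2 ^ p)
prodL p (suc n) = mul (2 ^ (p + 2 * n)) (prodL p n) (L (p + 2 * suc n))

matrixFormula : ℕ → ℕ → ℕ → ℕ
matrixFormula p q n =
  mul D (mul D P (powM D (C (p + 2 * n)) q)) (tr P) 0 0
  where
  D = 2 ^ (p + 2 * n)
  P = prodL p n

-- The expanded (p,q)-Aztec diamond AD_(p,q;n), placed in the lattice
-- ℕ × ℕ after translating by (p+2n)/2 horizontally:  cell (x , y) is the
-- unit square [x - (p+2n)/2, x+1 - (p+2n)/2] × [y, y+1].
-- Row j = y + 1 has length ℓ_j = p + 2 m_y and occupies columns
-- n - m_y ≤ x < n - m_y + p + 2 m_y.

halfExcess : ℕ → ℕ → ℕ → ℕ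
halfExcess q n y =
  if y <ᵇ n then suc y
  else if y <ᵇ n + q then n
  else (2 * n + q) ∸ y

inRegion : ℕ → ℕ → ℕ → ℕ → ℕ → Bool
inRegion p q n x y =
  (y <ᵇ 2 * n + q) ∧ ((o ≤ᵇ x) ∧ (x <ᵇ o + (p + 2 * m)))
  where
  m = halfExcess q n y
  o = n ∸ m

-- A domino: anchor cell (x , y) and orientation
-- (true = horizontal: cells (x,y),(x+1,y); false = vertical: cells (x,y),(x,y+1)).
Domino : Set
Domino = ℕ × ℕ × Bool

cell₁ : Domino → ℕ × ℕ
cell₁ (x , y , _) = x , y

cell₂ : Domino → ℕ × ℕ
cell₂ (x , y , true)  = suc x , y
cell₂ (x , y , false) = x , suc y

sameCell : ℕ × ℕ → ℕ × ℕ → Bool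
sameCell (a , b) (c , d) = (a ≡ᵇ c) ∧ (b ≡ᵇ d)

covers : Domino → ℕ × ℕ → Bool
covers D c = if sameCell (cell₁ D) c then true else sameCell (cell₂ D) c

-- all candidate dominoes anchored inside the bounding box
-- [0, p+2n) × [0, 2n+q) (every domino inside the region is one of these,
-- and distinct candidates are distinct rectangles)
candidates : ℕ → ℕ → ℕ → List Domino
candidates p q n =
  concatMap (λ x → concatMap (λ y → (x , y , true) ∷ (x , y , false) ∷ [])
                             (upTo (2 * n + q)))
            (upTo (p + 2 * n))

cellsBox : ℕ → ℕ → ℕ → List (ℕ × ℕ)
cellsBox p q n = concatMap (λ x → map (λ y → x , y) (upTo (2 * n + q))) (upTo (p + 2 * n))

subsets : {X : Set} → List X → List (List X)
subsets [] = [] ∷ []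
subsets (a ∷ as) = let r = subsets as in map (a ∷_) r ++ r

count : {X : Set} → (X → Bool) → List X → ℕ
count f xs = length (filter (λ x → T? (f x)) xs)

inReg : ℕ → ℕ → ℕ → ℕ × ℕ → Bool
inReg p q n (x , y) = inRegion p q n x y

isTiling : ℕ → ℕ → ℕ → List Domino → Bool
isTiling p q n ds =
  and (map (λ d → inReg p q n (cell₁ d) ∧ inReg p q n (cell₂ d)) ds)
  ∧ and (map (λ c → if inReg p q n c then count (λ d → covers d c) ds ≡ᵇ 1 else true)
        (cellsBox p q n))

α : ℕ → ℕ → ℕ → ℕ
α p q n = count (isTiling p q n) (subsets (candidates p q n))

module Submission where

-- Transfer-matrix method.  Sweep the diamond row by row.  A tiling is determined by its
-- horizontal dominoes in each row y and its vertical dominoes joining rows y and y + 1; the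
-- latter form a subset of the row boundary, encoded by a binary number j'.  Given the
-- vertical dominoes entering and leaving row y, the free cells of the row must be covered by
-- horizontal dominoes, which is possible in exactly one way when every run of free cells has
-- even length and in none otherwise.  Summing over the states row by row expresses α as a
-- product of transfer matrices, and reading the block recurrences of A_k, C_k and L_{p+2k} on
-- binary expansions shows that these transfer matrices are exactly L_{p+2k} on the widening
-- rows, C_{p+2n} on the q middle rows and the transposes L_{p+2k}ᵗ on the narrowing rows.

open import Defs
open import Data.Nat.Base
open import Data.Nat.Properties
open import Data.Nat.ListAction using (sum)
open import Data.Nat.Tactic.RingSolver using (solve-∀)
open import Data.Bool.Base using (Bool; true; false; _∧_; _∨_; if_then_else_; T)
open import Data.Bool.Properties using (T?; ∧-zeroʳ; ∧-identityʳ; ∨-zeroʳ)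
open import Data.Bool.ListAction using (and)
open import Data.List.Base
  using (List; []; _∷_; _++_; map; length; filter; concatMap; upTo; applyUpTo; replicate; zipWith)
open import Data.List.Properties
  using (map-cong; map-cong-local; map-++; length-map; ++-identityʳ; map-upTo; upTo-∷ʳ; zipWith-comm)
open import Data.List.Membership.Propositional using (_∈_; lose; find)
open import Data.List.Membership.Propositional.Properties
  using (∈-++⁻; ∈-++⁺ˡ; ∈-++⁺ʳ; ∈-map⁻; ∈-map⁺; ∈-∃++; ∈-filter⁻; ∈-filter⁺;
         ∈-concatMap⁺; ∈-concatMap⁻; ∈-upTo⁺; ∈-upTo⁻)
open import Data.List.Relation.Unary.Any using (here; there)
open import Data.List.Relation.Unary.All as All using (All; []; _∷_)
open import Data.List.Relation.Unary.AllPairs using ([]; _∷_)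
open import Data.List.Relation.Unary.Unique.Propositional using (Unique)
open import Data.List.Relation.Unary.Unique.Propositional.Properties using (++⁺; map⁺; upTo⁺; filter⁺)
open import Data.List.Relation.Binary.Permutation.Propositional as ↭ using (_↭_; ↭-sym)
open import Data.List.Relation.Binary.Permutation.Propositional.Properties using (shift)
open import Data.Product.Base using (_×_; _,_; proj₁; proj₂; ∃)
open import Data.Sum.Base using (_⊎_; inj₁; inj₂)
open import Data.Empty using (⊥-elim)
open import Relation.Nullary using (¬_; Dec; yes; no)
open import Relation.Binary.PropositionalEquality
open ≡-Reasoning

T⇒≡true : ∀ {b} → T b → b ≡ true
T⇒≡true {true} _ = refl

¬T⇒≡false : ∀ {b} → ¬ T b → b ≡ false
¬T⇒≡false {true} h = ⊥-elim (h _)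
¬T⇒≡false {false} _ = refl

≡true⇒T : ∀ {b} → b ≡ true → T b
≡true⇒T refl = _

<ᵇ-true : ∀ {m n} → m < n → (m <ᵇ n) ≡ true
<ᵇ-true p = T⇒≡true (<⇒<ᵇ p)

<ᵇ-false : ∀ {m n} → n ≤ m → (m <ᵇ n) ≡ false
<ᵇ-false {m} {n} p = ¬T⇒≡false (λ t → <⇒≱ (<ᵇ⇒< m n t) p)

≤ᵇ-true : ∀ {m n} → m ≤ n → (m ≤ᵇ n) ≡ true
≤ᵇ-true p = T⇒≡true (≤⇒≤ᵇ p)

≡ᵇ-true : ∀ {m n} → m ≡ n → (m ≡ᵇ n) ≡ true
≡ᵇ-true {m} {n} p = T⇒≡true (≡⇒≡ᵇ m n p)

≡ᵇ-false : ∀ {m n} → m ≢ n → (m ≡ᵇ n) ≡ false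
≡ᵇ-false {m} {n} p = ¬T⇒≡false (λ t → p (≡ᵇ⇒≡ m n t))

≡ᵇ-refl : ∀ n → (n ≡ᵇ n) ≡ true
≡ᵇ-refl n = ≡ᵇ-true {n} refl

≡ᵇ-sym : ∀ a b → (a ≡ᵇ b) ≡ (b ≡ᵇ a)
≡ᵇ-sym zero zero = refl
≡ᵇ-sym zero (suc b) = refl
≡ᵇ-sym (suc a) zero = refl
≡ᵇ-sym (suc a) (suc b) = ≡ᵇ-sym a b

<ᵇ-true⁻ : ∀ {m n} → (m <ᵇ n) ≡ true → m < n
<ᵇ-true⁻ {m} {n} e = <ᵇ⇒< m n (≡true⇒T e)

<ᵇ-false⁻ : ∀ {m n} → (m <ᵇ n) ≡ false → n ≤ m
<ᵇ-false⁻ {m} {n} e = ≮⇒≥ (λ p → subst T e (<⇒<ᵇ p))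

∧-true⁻ : ∀ {a b} → (a ∧ b) ≡ true → a ≡ true × b ≡ true
∧-true⁻ {true} {true} _ = refl , refl

∧-true : ∀ {a b} → a ≡ true → b ≡ true → (a ∧ b) ≡ true
∧-true refl refl = refl

∧-falseˡ : ∀ {a b} → a ≡ false → (a ∧ b) ≡ false
∧-falseˡ refl = refl

bool-ext : ∀ {a b : Bool} → (a ≡ true → b ≡ true) → (b ≡ true → a ≡ true) → a ≡ b
bool-ext {true} {true} f g = refl
bool-ext {true} {false} f g = sym (f refl)
bool-ext {false} {true} f g = g refl
bool-ext {false} {false} f g = refl

ind-∧ : ∀ a b → ind (a ∧ b) ≡ ind a * ind b
ind-∧ true b = sym (+-identityʳ (ind b))
ind-∧ false b = refl

ind-false : ∀ {b} → b ≡ false → ind b ≡ 0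
ind-false refl = refl

and-++ : (xs ys : List Bool) → and (xs ++ ys) ≡ (and xs ∧ and ys)
and-++ [] ys = refl
and-++ (true ∷ xs) ys = and-++ xs ys
and-++ (false ∷ xs) ys = refl

and-map-true : {X : Set} (g : X → Bool) (xs : List X) → (∀ x → x ∈ xs → g x ≡ true) → and (map g xs) ≡ true
and-map-true g [] h = refl
and-map-true g (x ∷ xs) h rewrite h x (here refl) = and-map-true g xs (λ z m → h z (there m))

and-map-true⁻ : {X : Set} (g : X → Bool) (xs : List X) → and (map g xs) ≡ true → ∀ x → x ∈ xs → g x ≡ true
and-map-true⁻ g (x ∷ xs) e z (here refl) = proj₁ (∧-true⁻ {g x} e)
and-map-true⁻ g (x ∷ xs) e z (there m) = and-map-true⁻ g xs (proj₂ (∧-true⁻ {g x} e)) z m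

and-map-false : {X : Set} (f : X → Bool) {S : List X} {z : X} → z ∈ S → f z ≡ false → and (map f S) ≡ false
and-map-false f (here refl) e rewrite e = refl
and-map-false f {x ∷ S} (there m) e rewrite and-map-false f m e = ∧-zeroʳ (f x)

and-map-↭ : {X : Set} (f : X → Bool) {S S' : List X} → S ↭ S' → and (map f S) ≡ and (map f S')
and-map-↭ f ↭.refl = refl
and-map-↭ f (↭.prep x p) = cong (f x ∧_) (and-map-↭ f p)
and-map-↭ f (↭.swap x y p) = trans (cong (λ r → f x ∧ (f y ∧ r)) (and-map-↭ f p)) (swap (f x) (f y) _)
  where
  swap : ∀ a b r → a ∧ (b ∧ r) ≡ b ∧ (a ∧ r)
  swap true b r = refl
  swap false true r = refl
  swap false false r = refl
and-map-↭ f (↭.trans p q) = trans (and-map-↭ f p) (and-map-↭ f q)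

sumMap : {X : Set} → (X → ℕ) → List X → ℕ
sumMap f xs = sum (map f xs)

sumTo : (ℕ → ℕ) → ℕ → ℕ
sumTo f n = sumMap f (upTo n)

sumMap-++ : {X : Set} (f : X → ℕ) (xs ys : List X) → sumMap f (xs ++ ys) ≡ sumMap f xs + sumMap f ys
sumMap-++ f [] ys = refl
sumMap-++ f (x ∷ xs) ys = trans (cong (f x +_) (sumMap-++ f xs ys)) (sym (+-assoc (f x) _ _))

sumMap-map : {X Y : Set} (f : Y → ℕ) (g : X → Y) (xs : List X) → sumMap f (map g xs) ≡ sumMap (λ x → f (g x)) xs
sumMap-map f g [] = refl
sumMap-map f g (x ∷ xs) = cong (f (g x) +_) (sumMap-map f g xs)

sumMap-cong : {X : Set} {f g : X → ℕ} (xs : List X) → (∀ x → x ∈ xs → f x ≡ g x) → sumMap f xs ≡ sumMap g xs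
sumMap-cong [] h = refl
sumMap-cong (x ∷ xs) h = cong₂ _+_ (h x (here refl)) (sumMap-cong xs (λ y m → h y (there m)))

sumMap-zero : {X : Set} {f : X → ℕ} (xs : List X) → (∀ x → x ∈ xs → f x ≡ 0) → sumMap f xs ≡ 0
sumMap-zero [] h = refl
sumMap-zero (x ∷ xs) h = cong₂ _+_ (h x (here refl)) (sumMap-zero xs (λ y m → h y (there m)))

sumMap-*ˡ : {X : Set} (k : ℕ) (f : X → ℕ) (xs : List X) → sumMap (λ x → k * f x) xs ≡ k * sumMap f xs
sumMap-*ˡ k f [] = sym (*-zeroʳ k)
sumMap-*ˡ k f (x ∷ xs) = trans (cong (k * f x +_) (sumMap-*ˡ k f xs)) (sym (*-distribˡ-+ k (f x) _))

+-exchange : ∀ a b c d → a + b + (c + d) ≡ a + c + (b + d)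
+-exchange = solve-∀

sumMap-+ : {X : Set} (f g : X → ℕ) (xs : List X) → sumMap (λ x → f x + g x) xs ≡ sumMap f xs + sumMap g xs
sumMap-+ f g [] = refl
sumMap-+ f g (x ∷ xs) rewrite sumMap-+ f g xs = +-exchange (f x) (g x) (sumMap f xs) (sumMap g xs)

sumMap-swap : {X Y : Set} (f : X → Y → ℕ) (xs : List X) (ys : List Y) →
  sumMap (λ x → sumMap (f x) ys) xs ≡ sumMap (λ y → sumMap (λ x → f x y) xs) ys
sumMap-swap f [] ys = sym (sumMap-zero ys (λ _ _ → refl))
sumMap-swap f (x ∷ xs) ys =
  trans (cong (sumMap (f x) ys +_) (sumMap-swap f xs ys)) (sym (sumMap-+ (f x) (λ y → sumMap (λ x → f x y) xs) ys))

sumMap-↭ : {X : Set} (f : X → ℕ) {S S' : List X} → S ↭ S' → sumMap f S ≡ sumMap f S'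
sumMap-↭ f ↭.refl = refl
sumMap-↭ f (↭.prep x p) = cong (f x +_) (sumMap-↭ f p)
sumMap-↭ f (↭.swap {xs} {ys} x y p) =
  trans (cong (λ r → f x + (f y + r)) (sumMap-↭ f p))
        (trans (sym (+-assoc (f x) (f y) _)) (trans (cong (_+ sumMap f ys) (+-comm (f x) (f y))) (+-assoc (f y) (f x) _)))
sumMap-↭ f (↭.trans p q) = trans (sumMap-↭ f p) (sumMap-↭ f q)

count≡sumMap : {X : Set} (f : X → Bool) (xs : List X) → count f xs ≡ sumMap (λ x → ind (f x)) xs
count≡sumMap f [] = refl
count≡sumMap f (x ∷ xs) with f x
... | true = cong suc (count≡sumMap f xs)
... | false = count≡sumMap f xs

count-++ : {X : Set} (f : X → Bool) (xs ys : List X) → count f (xs ++ ys) ≡ count f xs + count f ys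
count-++ f xs ys =
  trans (count≡sumMap f (xs ++ ys)) (trans (sumMap-++ _ xs ys) (sym (cong₂ _+_ (count≡sumMap f xs) (count≡sumMap f ys))))

count-zero : {X : Set} (f : X → Bool) (xs : List X) → (∀ x → x ∈ xs → f x ≡ false) → count f xs ≡ 0
count-zero f xs h = trans (count≡sumMap f xs) (sumMap-zero xs (λ x m → cong ind (h x m)))

count-↭ : {X : Set} (f : X → Bool) {S S' : List X} → S ↭ S' → count f S ≡ count f S'
count-↭ f {S} {S'} p = trans (count≡sumMap f S) (trans (sumMap-↭ _ p) (sym (count≡sumMap f S')))

sumMap-subsets-∷ : {X : Set} (F : List X → ℕ) (x : X) (xs : List X) →
  sumMap F (subsets (x ∷ xs)) ≡ sumMap (λ S → F (x ∷ S)) (subsets xs) + sumMap F (subsets xs)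
sumMap-subsets-∷ F x xs =
  trans (sumMap-++ F (map (x ∷_) (subsets xs)) (subsets xs)) (cong (_+ sumMap F (subsets xs)) (sumMap-map F (x ∷_) (subsets xs)))

sumMap-subsets-++ : {X : Set} (F : List X → ℕ) (xs ys : List X) →
  sumMap F (subsets (xs ++ ys)) ≡ sumMap (λ S → sumMap (λ T → F (S ++ T)) (subsets ys)) (subsets xs)
sumMap-subsets-++ F [] ys = sym (+-identityʳ _)
sumMap-subsets-++ F (x ∷ xs) ys =
  trans (sumMap-subsets-∷ F x (xs ++ ys))
  (trans (cong₂ _+_ (sumMap-subsets-++ (λ S → F (x ∷ S)) xs ys) (sumMap-subsets-++ F xs ys))
  (sym (sumMap-subsets-∷ (λ S → sumMap (λ T → F (S ++ T)) (subsets ys)) x xs)))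

∈-subsets⇒⊆ : {X : Set} (xs : List X) {S : List X} {z : X} → S ∈ subsets xs → z ∈ S → z ∈ xs
∈-subsets⇒⊆ [] (here refl) ()
∈-subsets⇒⊆ [] (there ())
∈-subsets⇒⊆ (x ∷ xs) m zm with ∈-++⁻ (map (x ∷_) (subsets xs)) m
... | inj₂ m' = there (∈-subsets⇒⊆ xs m' zm)
... | inj₁ m' with ∈-map⁻ (x ∷_) m'
... | S' , m'' , refl with zm
... | here refl = here refl
... | there zm' = there (∈-subsets⇒⊆ xs m'' zm')

sumMap-subsets-↭ : {X : Set} {xs ys : List X} → xs ↭ ys → (F G : List X → ℕ) →
  (∀ {S S'} → S ↭ S' → F S ≡ G S') → sumMap F (subsets xs) ≡ sumMap G (subsets ys)
sumMap-subsets-↭ {xs = xs} ↭.refl F G h = sumMap-cong (subsets xs) (λ S _ → h ↭.refl)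
sumMap-subsets-↭ {xs = _ ∷ xs} {ys = _ ∷ ys} (↭.prep x p) F G h =
  trans (sumMap-subsets-∷ F x xs)
  (trans (cong₂ _+_ (sumMap-subsets-↭ p (λ S → F (x ∷ S)) (λ S → G (x ∷ S)) (λ r → h (↭.prep x r)))
                    (sumMap-subsets-↭ p F G h))
  (sym (sumMap-subsets-∷ G x ys)))
sumMap-subsets-↭ {xs = x ∷ y ∷ xs} {ys = y ∷ x ∷ ys} (↭.swap x y p) F G h =
  begin
    sumMap F (subsets (x ∷ y ∷ xs))
  ≡⟨ trans (sumMap-subsets-∷ F x (y ∷ xs)) (cong₂ _+_ (sumMap-subsets-∷ _ y xs) (sumMap-subsets-∷ F y xs)) ⟩
    over F (λ S → x ∷ y ∷ S) xs + over F (x ∷_) xs + (over F (y ∷_) xs + over F (λ S → S) xs)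
  ≡⟨ cong₂ _+_ (cong₂ _+_ (sumMap-subsets-↭ p _ _ (λ r → h (↭.swap x y r))) (sumMap-subsets-↭ p _ _ (λ r → h (↭.prep x r))))
               (cong₂ _+_ (sumMap-subsets-↭ p _ _ (λ r → h (↭.prep y r))) (sumMap-subsets-↭ p F G h)) ⟩
    over G (λ S → y ∷ x ∷ S) ys + over G (x ∷_) ys + (over G (y ∷_) ys + over G (λ S → S) ys)
  ≡⟨ +-exchange (over G (λ S → y ∷ x ∷ S) ys) (over G (x ∷_) ys) (over G (y ∷_) ys) (over G (λ S → S) ys) ⟩
    over G (λ S → y ∷ x ∷ S) ys + over G (y ∷_) ys + (over G (x ∷_) ys + over G (λ S → S) ys)
  ≡⟨ sym (trans (sumMap-subsets-∷ G y (x ∷ ys)) (cong₂ _+_ (sumMap-subsets-∷ _ x ys) (sumMap-subsets-∷ G x ys))) ⟩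
    sumMap G (subsets (y ∷ x ∷ ys))
  ∎
  where
  over : (List _ → ℕ) → (List _ → List _) → List _ → ℕ
  over H e zs = sumMap (λ S → H (e S)) (subsets zs)
sumMap-subsets-↭ (↭.trans p q) F G h =
  trans (sumMap-subsets-↭ p F F (λ r → trans (h r) (sym (h ↭.refl)))) (sumMap-subsets-↭ q F G h)

sumMap-subsets-filter : {X : Set} (good : X → Bool) (xs : List X) (F : List X → ℕ) →
  (∀ S z → z ∈ S → good z ≡ false → F S ≡ 0) →
  sumMap F (subsets xs) ≡ sumMap F (subsets (filter (λ z → T? (good z)) xs))
sumMap-subsets-filter good [] F h = refl
sumMap-subsets-filter good (x ∷ xs) F h with good x in eq
... | true =
  trans (sumMap-subsets-∷ F x xs)
  (trans (cong₂ _+_ (sumMap-subsets-filter good xs (λ S → F (x ∷ S)) (λ S z m g → h (x ∷ S) z (there m) g))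
                    (sumMap-subsets-filter good xs F h))
  (sym (sumMap-subsets-∷ F x (filter (λ z → T? (good z)) xs))))
... | false =
  trans (sumMap-subsets-∷ F x xs)
  (trans (cong (_+ sumMap F (subsets xs)) (sumMap-zero (subsets xs) (λ S _ → h (x ∷ S) x (here refl) eq)))
  (sumMap-subsets-filter good xs F h))

module _ {X : Set} where

  private
    All-remove : {P : X → Set} (ys₁ : List X) {x : X} {ys₂ : List X} → All P (ys₁ ++ x ∷ ys₂) → All P (ys₁ ++ ys₂)
    All-remove [] (_ ∷ a) = a
    All-remove (y ∷ ys₁) (py ∷ a) = py ∷ All-remove ys₁ a

    All-middle : {P : X → Set} (ys₁ : List X) {x : X} {ys₂ : List X} → All P (ys₁ ++ x ∷ ys₂) → P x
    All-middle [] (px ∷ _) = px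
    All-middle (y ∷ ys₁) (_ ∷ a) = All-middle ys₁ a

    Unique-remove : (ys₁ : List X) {x : X} {ys₂ : List X} → Unique (ys₁ ++ x ∷ ys₂) → Unique (ys₁ ++ ys₂)
    Unique-remove [] (_ ∷ u) = u
    Unique-remove (y ∷ ys₁) (py ∷ u) = All-remove ys₁ py ∷ Unique-remove ys₁ u

    ∈-remove : (ys₁ : List X) {x z : X} {ys₂ : List X} → z ∈ ys₁ ++ x ∷ ys₂ → z ≢ x → z ∈ ys₁ ++ ys₂
    ∈-remove [] (here e) ne = ⊥-elim (ne e)
    ∈-remove [] (there m) ne = m
    ∈-remove (y ∷ ys₁) (here e) ne = here e
    ∈-remove (y ∷ ys₁) (there m) ne = there (∈-remove ys₁ m ne)

    ∈-insert : (ys₁ : List X) {x z : X} {ys₂ : List X} → z ∈ ys₁ ++ ys₂ → z ∈ ys₁ ++ x ∷ ys₂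
    ∈-insert [] m = there m
    ∈-insert (y ∷ ys₁) (here e) = here e
    ∈-insert (y ∷ ys₁) (there m) = there (∈-insert ys₁ m)

    Unique⇒≢middle : (ys₁ : List X) {x z : X} {ys₂ : List X} → Unique (ys₁ ++ x ∷ ys₂) → z ∈ ys₁ ++ ys₂ → z ≢ x
    Unique⇒≢middle [] (px ∷ u) m refl = All.lookup px m refl
    Unique⇒≢middle (y ∷ ys₁) (py ∷ u) (here refl) refl = All-middle ys₁ py refl
    Unique⇒≢middle (y ∷ ys₁) (py ∷ u) (there m) = Unique⇒≢middle ys₁ u m

  Unique-⊆-⊇⇒↭ : {xs ys : List X} → Unique xs → Unique ys →
    (∀ {z} → z ∈ xs → z ∈ ys) → (∀ {z} → z ∈ ys → z ∈ xs) → xs ↭ ys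
  Unique-⊆-⊇⇒↭ {[]} {[]} ux uy f g = ↭.refl
  Unique-⊆-⊇⇒↭ {[]} {y ∷ ys} ux uy f g with g (here refl)
  ... | ()
  Unique-⊆-⊇⇒↭ {x ∷ xs} (px ∷ ux) uy f g with ∈-∃++ (f (here refl))
  ... | ys₁ , ys₂ , refl =
    ↭.trans (↭.prep x (Unique-⊆-⊇⇒↭ ux (Unique-remove ys₁ uy)
              (λ m → ∈-remove ys₁ (f (there m)) (λ e → All.lookup px m (sym e)))
              back))
            (↭-sym (shift x ys₁ ys₂))
    where
    back : ∀ {z} → z ∈ ys₁ ++ ys₂ → z ∈ xs
    back m with g (∈-insert ys₁ m)
    ... | here e = ⊥-elim (Unique⇒≢middle ys₁ uy m e)
    ... | there m' = m'

sumTo-cong : ∀ {f g : ℕ → ℕ} n → (∀ i → i < n → f i ≡ g i) → sumTo f n ≡ sumTo g n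
sumTo-cong n h = sumMap-cong (upTo n) (λ i m → h i (∈-upTo⁻ m))

applyUpTo-+ : ∀ {X : Set} (f : ℕ → X) a b → applyUpTo f (a + b) ≡ applyUpTo f a ++ applyUpTo (λ i → f (a + i)) b
applyUpTo-+ f zero b = refl
applyUpTo-+ f (suc a) b = cong (f 0 ∷_) (applyUpTo-+ (λ i → f (suc i)) a b)

sumTo-+ : ∀ (f : ℕ → ℕ) a b → sumTo f (a + b) ≡ sumTo f a + sumTo (λ i → f (a + i)) b
sumTo-+ f a b =
  trans (cong (sumMap f) (applyUpTo-+ (λ i → i) a b))
  (trans (sumMap-++ f (upTo a) _)
  (cong (sumTo f a +_) (trans (cong (sumMap f) (sym (map-upTo (a +_) b))) (sumMap-map f (a +_) (upTo b)))))

sumTo-indicatorˡ : ∀ (g : ℕ → ℕ) n i → i < n → sumTo (λ t → ind (i ≡ᵇ t) * g t) n ≡ g i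
sumTo-indicatorˡ g (suc n) i i<n with i ≟ n
... | yes refl =
  trans (cong (sumMap _) (sym (upTo-∷ʳ n)))
  (trans (sumMap-++ _ (upTo n) (n ∷ []))
  (trans (cong₂ _+_ (sumMap-zero (upTo n) (λ t m → cong (λ b → ind b * g t) (≡ᵇ-false (λ e → <-irrefl (sym e) (∈-upTo⁻ m)))))
                    (cong (λ b → ind b * g n + 0) (≡ᵇ-refl n)))
  (trans (+-identityʳ _) (+-identityʳ _))))
... | no i≢n =
  trans (cong (sumMap _) (sym (upTo-∷ʳ n)))
  (trans (sumMap-++ _ (upTo n) (n ∷ []))
  (trans (cong₂ _+_ (sumTo-indicatorˡ g n i (≤∧≢⇒< (≤-pred i<n) i≢n)) (cong (λ b → ind b * g n + 0) (≡ᵇ-false i≢n)))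
  (+-identityʳ _)))

sumTo-indicatorʳ : ∀ (g : ℕ → ℕ) n i → i < n → sumTo (λ t → g t * ind (t ≡ᵇ i)) n ≡ g i
sumTo-indicatorʳ g n i i<n =
  trans (sumTo-cong n (λ t _ → trans (*-comm (g t) _) (cong (λ b → ind b * g t) (≡ᵇ-sym t i)))) (sumTo-indicatorˡ g n i i<n)

sumTo-*ʳ : ∀ (f : ℕ → ℕ) c n → sumTo (λ t → f t * c) n ≡ sumTo f n * c
sumTo-*ʳ f c n = trans (sumTo-cong n (λ t _ → *-comm (f t) c)) (trans (sumMap-*ˡ c f (upTo n)) (*-comm c _))

sumTo-swap : ∀ (f : ℕ → ℕ → ℕ) n m → sumTo (λ i → sumTo (f i) m) n ≡ sumTo (λ j → sumTo (λ i → f i j) n) m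
sumTo-swap f n m = sumMap-swap f (upTo n) (upTo m)

mul-assoc : ∀ d e (M N K : Mat) i j → mul d (mul e M N) K i j ≡ mul e M (mul d N K) i j
mul-assoc d e M N K i j =
  trans (sumTo-cong d (λ t _ → sym (sumTo-*ʳ (λ u → M i u * N u t) (K t j) e)))
  (trans (sumTo-swap (λ t u → M i u * N u t * K t j) d e)
  (sumTo-cong e (λ u _ → trans (sumTo-cong d (λ t _ → *-assoc (M i u) (N u t) (K t j)))
                                (sumMap-*ˡ (M i u) (λ t → N u t * K t j) (upTo d)))))

mul-identityˡ : ∀ d (M : Mat) i j → i < d → mul d (idM d) M i j ≡ M i j
mul-identityˡ d M i j i<d =
  trans (sumTo-cong d (λ t _ → cong (λ b → ind b * M t j) (trans (cong ((i ≡ᵇ t) ∧_) (<ᵇ-true i<d)) (∧-identityʳ _))))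
        (sumTo-indicatorˡ (λ t → M t j) d i i<d)

mul-identityʳ : ∀ d (M : Mat) i j → j < d → mul d M (idM d) i j ≡ M i j
mul-identityʳ d M i j j<d =
  trans (sumTo-cong d (λ t t<d → cong (λ b → M i t * ind b) (trans (cong ((t ≡ᵇ j) ∧_) (<ᵇ-true t<d)) (∧-identityʳ _))))
        (sumTo-indicatorʳ (M i) d j j<d)

mul-cong : ∀ d {M M' N N' : Mat} i j →
  (∀ t → t < d → M i t ≡ M' i t) → (∀ t → t < d → N t j ≡ N' t j) → mul d M N i j ≡ mul d M' N' i j
mul-cong d i j h1 h2 = sumTo-cong d (λ t t<d → cong₂ _*_ (h1 t t<d) (h2 t t<d))

powM-suc : ∀ d (M : Mat) r i j → i < d → j < d → powM d M (suc r) i j ≡ mul d M (powM d M r) i j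
powM-suc d M zero i j i<d j<d = trans (mul-identityˡ d M i j i<d) (sym (mul-identityʳ d M i j j<d))
powM-suc d M (suc r) i j i<d j<d =
  trans (mul-cong d {M = powM d M (suc r)} {M' = mul d M (powM d M r)} {N = M} {N' = M} i j (λ t t<d → powM-suc d M r i t i<d t<d) (λ _ _ → refl))
        (mul-assoc d d M (powM d M r) M i j)

-- The sublist selecting the entries at the 1-digits of the (length xs)-digit expansion of j,
-- most significant digit first.
select : {X : Set} → List X → ℕ → List X
select [] j = []
select (v ∷ vs) j = if j <ᵇ 2 ^ length vs then select vs j else v ∷ select vs (j ∸ 2 ^ length vs)

select-⊆ : {X : Set} (xs : List X) (j : ℕ) {z : X} → z ∈ select xs j → z ∈ xs
select-⊆ [] j ()
select-⊆ (v ∷ vs) j m with j <ᵇ 2 ^ length vs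
... | true = there (select-⊆ vs j m)
... | false with m
... | here e = here e
... | there m' = there (select-⊆ vs (j ∸ 2 ^ length vs) m')

sumMap-subsets≡sumTo-select : {X : Set} (F : List X → ℕ) (xs : List X) →
  sumMap F (subsets xs) ≡ sumTo (λ j → F (select xs j)) (2 ^ length xs)
sumMap-subsets≡sumTo-select F [] = refl
sumMap-subsets≡sumTo-select F (v ∷ vs) =
  trans (sumMap-subsets-∷ F v vs)
  (trans (cong₂ _+_ (sumMap-subsets≡sumTo-select (λ S → F (v ∷ S)) vs) (sumMap-subsets≡sumTo-select F vs))
  (trans (+-comm (sumTo (λ j → F (v ∷ select vs j)) N) (sumTo (λ j → F (select vs j)) N))
  (sym (trans (sumTo-+ (λ j → F (select (v ∷ vs) j)) N (N + 0))
  (cong₂ _+_ (sumTo-cong N (λ j j< → cong (λ b → F (if b then select vs j else v ∷ select vs (j ∸ N))) (<ᵇ-true j<)))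
             (trans (cong (sumTo _) (+-identityʳ N))
               (sumTo-cong N (λ i _ → trans (cong (λ b → F (if b then select vs (N + i) else v ∷ select vs (N + i ∸ N))) (<ᵇ-false (m≤m+n N i)))
                                           (cong (λ k → F (v ∷ select vs k)) (m+n∸m≡n N i))))))))))
  where
  N : ℕ
  N = 2 ^ length vs

bits : ℕ → ℕ → List ℕ
bits zero j = []
bits (suc w) j = if j <ᵇ 2 ^ w then 0 ∷ bits w j else 1 ∷ bits w (j ∸ 2 ^ w)

bits-suc-< : ∀ w j → j < 2 ^ w → bits (suc w) j ≡ 0 ∷ bits w j
bits-suc-< w j h rewrite <ᵇ-true h = refl

bits-suc-≥ : ∀ w j → 2 ^ w ≤ j → bits (suc w) j ≡ 1 ∷ bits w (j ∸ 2 ^ w)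
bits-suc-≥ w j h rewrite <ᵇ-false h = refl

bits-zero : ∀ w → bits w 0 ≡ replicate w 0
bits-zero zero = refl
bits-zero (suc w) = trans (bits-suc-< w 0 (m^n>0 2 w)) (cong (0 ∷_) (bits-zero w))

2^-suc : ∀ w → 2 ^ suc w ≡ 2 ^ w + 2 ^ w
2^-suc w = e (2 ^ w)
  where
  e : ∀ x → 2 * x ≡ x + x
  e = solve-∀

2^≤2^-suc : ∀ w → 2 ^ w ≤ 2 ^ suc w
2^≤2^-suc w = ≤-trans (m≤n+m (2 ^ w) (2 ^ w)) (≤-reflexive (sym (2^-suc w)))

∸2^<2^ : ∀ w j → 2 ^ w ≤ j → j < 2 ^ suc w → j ∸ 2 ^ w < 2 ^ w
∸2^<2^ w j h1 h2 =
  +-cancelˡ-< (2 ^ w) (j ∸ 2 ^ w) (2 ^ w) (subst (_< 2 ^ w + 2 ^ w) (sym (m+[n∸m]≡n h1)) (subst (j <_) (2^-suc w) h2))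

2^≤∸2^ : ∀ w x → 2 ^ suc w ≤ x → 2 ^ w ≤ x ∸ 2 ^ w
2^≤∸2^ w x hx =
  +-cancelˡ-≤ (2 ^ w) (2 ^ w) (x ∸ 2 ^ w)
    (subst (_≤ 2 ^ w + (x ∸ 2 ^ w)) (2^-suc w) (subst (2 ^ suc w ≤_) (sym (m+[n∸m]≡n (≤-trans (2^≤2^-suc w) hx))) hx))

-- Filling a row with horizontal dominoes

-- fillings xs is the number of ways to bring every entry of the occupancy vector xs to
-- exactly 1 by adding horizontal dominoes, each adding 1 to two consecutive entries.
fillingsFrom : ℕ → List ℕ → ℕ
fillingsFrom x [] = ind (x ≡ᵇ 1)
fillingsFrom x (y ∷ ys) = ind (x ≡ᵇ 1) * fillingsFrom y ys + ind (x ≡ᵇ 0) * fillingsFrom (suc y) ys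

fillings : List ℕ → ℕ
fillings [] = 1
fillings (x ∷ xs) = fillingsFrom x xs

fillingsFrom-1 : ∀ xs → fillingsFrom 1 xs ≡ fillings xs
fillingsFrom-1 [] = refl
fillingsFrom-1 (x ∷ xs) = trans (+-identityʳ _) (+-identityʳ _)

fillingsFrom-≥2 : ∀ a xs → fillingsFrom (suc (suc a)) xs ≡ 0
fillingsFrom-≥2 a [] = refl
fillingsFrom-≥2 a (x ∷ xs) = refl

occupyHead : List ℕ → List ℕ
occupyHead [] = 2 ∷ []
occupyHead (x ∷ xs) = suc x ∷ xs

fillingsFrom-0 : ∀ xs → fillingsFrom 0 xs ≡ fillings (occupyHead xs)
fillingsFrom-0 [] = refl
fillingsFrom-0 (x ∷ xs) = +-identityʳ _

-- The matrices A, C and L as fillings of the union of two binary expansions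

dec-elim : {P X : Set} → Dec P → (P → X) → (¬ P → X) → X
dec-elim (yes p) f g = f p
dec-elim (no p) f g = g p

2^suc≤⇒2^≤ : ∀ k x → 2 ^ suc k ≤ x → 2 ^ k ≤ x
2^suc≤⇒2^≤ k x h = ≤-trans (2^≤2^-suc k) h

module _ (k i j : ℕ) where
  private
    h w : ℕ
    h = 2 ^ suc k
    w = 2 ^ suc (suc k)

  A-ll : i < h → j < w → A (suc (suc (suc k))) i j ≡ A (suc k) i j
  A-ll a b rewrite <ᵇ-true a | <ᵇ-true b = refl
  A-lh : i < h → w ≤ j → A (suc (suc (suc k))) i j ≡ A (suc (suc k)) i (j ∸ w)
  A-lh a b rewrite <ᵇ-true a | <ᵇ-false b = refl
  A-hl : h ≤ i → j < w → A (suc (suc (suc k))) i j ≡ A (suc (suc k)) (i ∸ h) j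
  A-hl a b rewrite <ᵇ-false a | <ᵇ-true b = refl
  A-hh : h ≤ i → w ≤ j → A (suc (suc (suc k))) i j ≡ 0
  A-hh a b rewrite <ᵇ-false a | <ᵇ-false b = refl

A-beyondRows : ∀ k i j → 2 ^ k ≤ i → A (suc k) i j ≡ 0
A-beyondRows zero (suc i) j h = refl
A-beyondRows (suc zero) (suc zero) j (s≤s ())
A-beyondRows (suc zero) (suc (suc i)) j h = refl
A-beyondRows (suc (suc k)) i j hi = dec-elim (j <? 2 ^ suc (suc k)) (λ b → trans (A-hl k i j (2^suc≤⇒2^≤ (suc k) i hi) b) (A-beyondRows (suc k) (i ∸ 2 ^ suc k) j (2^≤∸2^ (suc k) i hi)))
  (λ b → A-hh k i j (2^suc≤⇒2^≤ (suc k) i hi) (≮⇒≥ b))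

A-beyondCols : ∀ k i j → 2 ^ suc k ≤ j → A (suc k) i j ≡ 0
A-beyondCols zero i (suc zero) (s≤s ())
A-beyondCols zero zero (suc (suc j)) h = refl
A-beyondCols zero (suc i) (suc (suc j)) h = refl
A-beyondCols (suc zero) i zero ()
A-beyondCols (suc zero) i (suc zero) (s≤s ())
A-beyondCols (suc zero) i (suc (suc zero)) (s≤s (s≤s ()))
A-beyondCols (suc zero) i (suc (suc (suc zero))) (s≤s (s≤s (s≤s ())))
A-beyondCols (suc zero) zero (suc (suc (suc (suc j)))) h = refl
A-beyondCols (suc zero) (suc zero) (suc (suc (suc (suc j)))) h = refl
A-beyondCols (suc zero) (suc (suc i)) (suc (suc (suc (suc j)))) h = refl
A-beyondCols (suc (suc k)) i j hj = dec-elim (i <? 2 ^ suc k) (λ a → trans (A-lh k i j a (2^suc≤⇒2^≤ (suc (suc k)) j hj)) (A-beyondCols (suc k) i (j ∸ 2 ^ suc (suc k)) (2^≤∸2^ (suc (suc k)) j hj)))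
  (λ a → A-hh k i j (≮⇒≥ a) (2^suc≤⇒2^≤ (suc (suc k)) j hj))

module _ (k i j : ℕ) where
  private
    h : ℕ
    h = 2 ^ suc k

  C-ll : i < h → j < h → C (suc (suc k)) i j ≡ C k i j
  C-ll a b rewrite <ᵇ-true a | <ᵇ-true b = refl
  C-lh : i < h → h ≤ j → C (suc (suc k)) i j ≡ C (suc k) i (j ∸ h)
  C-lh a b rewrite <ᵇ-true a | <ᵇ-false b = refl
  C-hl : h ≤ i → j < h → C (suc (suc k)) i j ≡ C (suc k) (i ∸ h) j
  C-hl a b rewrite <ᵇ-false a | <ᵇ-true b = refl
  C-hh : h ≤ i → h ≤ j → C (suc (suc k)) i j ≡ 0
  C-hh a b rewrite <ᵇ-false a | <ᵇ-false b = refl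

C-beyondRows : ∀ k i j → 2 ^ k ≤ i → C k i j ≡ 0
C-beyondRows zero (suc i) j h = refl
C-beyondRows (suc zero) (suc zero) j (s≤s ())
C-beyondRows (suc zero) (suc (suc i)) j h = refl
C-beyondRows (suc (suc k)) i j hi = dec-elim (j <? 2 ^ suc k)
  (λ b → trans (C-hl k i j (2^suc≤⇒2^≤ (suc k) i hi) b) (C-beyondRows (suc k) (i ∸ 2 ^ suc k) j (2^≤∸2^ (suc k) i hi)))
  (λ b → C-hh k i j (2^suc≤⇒2^≤ (suc k) i hi) (≮⇒≥ b))

C-beyondCols : ∀ k i j → 2 ^ k ≤ j → C k i j ≡ 0
C-beyondCols zero zero (suc j) h = refl
C-beyondCols zero (suc i) (suc j) h = refl
C-beyondCols (suc zero) i (suc zero) (s≤s ())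
C-beyondCols (suc zero) zero (suc (suc j)) h = refl
C-beyondCols (suc zero) (suc zero) (suc (suc j)) h = refl
C-beyondCols (suc zero) (suc (suc i)) (suc (suc j)) h = refl
C-beyondCols (suc (suc k)) i j hj = dec-elim (i <? 2 ^ suc k)
  (λ a → trans (C-lh k i j a (2^suc≤⇒2^≤ (suc k) j hj)) (C-beyondCols (suc k) i (j ∸ 2 ^ suc k) (2^≤∸2^ (suc k) j hj)))
  (λ a → C-hh k i j (≮⇒≥ a) (2^suc≤⇒2^≤ (suc k) j hj))

-- Rows of m + 1 cells whose incoming vertical dominoes can only occupy the first m cells.
A-Fillings : ℕ → Set
A-Fillings m = ∀ j j' → j < 2 ^ m → j' < 2 ^ suc m → A (suc m) j j' ≡ fillings (zipWith _+_ (bits m j ++ 0 ∷ []) (bits (suc m) j'))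

-- The block [[A_{k+1}, O], [O, O]] of A_{k+3}: an extra occupied cell in front of the row.
A-fillings-padded : ∀ k → A-Fillings k → ∀ j j' → j < 2 ^ suc k → j' < 2 ^ suc (suc k) →
  A (suc k) j j' ≡ fillings (occupyHead (zipWith _+_ (bits (suc k) j ++ 0 ∷ []) (bits (suc (suc k)) j')))
A-fillings-padded k ih j j' hj hj' = dec-elim (j <? 2 ^ k)
  (λ a → dec-elim (j' <? 2 ^ suc k)
     (λ b → trans (ih j j' a b) (trans (sym (fillingsFrom-1 (Zf j j'))) (cong (λ z → fillings (occupyHead z)) (sym (cong₂ (zipWith _+_) (cong (_++ 0 ∷ []) (bits-suc-< k j a)) (bits-suc-< (suc k) j' b))))))
     (λ b → trans (A-beyondCols k j j' (≮⇒≥ b)) (sym (trans (cong (λ z → fillings (occupyHead z)) (cong₂ (zipWith _+_) (cong (_++ 0 ∷ []) (bits-suc-< k j a)) (bits-suc-≥ (suc k) j' (≮⇒≥ b)))) (fillingsFrom-≥2 0 (Zf j (j' ∸ 2 ^ suc k)))))))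
  (λ a → trans (A-beyondRows k j j' (≮⇒≥ a)) (sym (dec-elim (j' <? 2 ^ suc k)
     (λ b → trans (cong (λ z → fillings (occupyHead z)) (cong₂ (zipWith _+_) (cong (_++ 0 ∷ []) (bits-suc-≥ k j (≮⇒≥ a))) (bits-suc-< (suc k) j' b))) (fillingsFrom-≥2 0 (Zf (j ∸ 2 ^ k) j')))
     (λ b → trans (cong (λ z → fillings (occupyHead z)) (cong₂ (zipWith _+_) (cong (_++ 0 ∷ []) (bits-suc-≥ k j (≮⇒≥ a))) (bits-suc-≥ (suc k) j' (≮⇒≥ b)))) (fillingsFrom-≥2 1 (Zf (j ∸ 2 ^ k) (j' ∸ 2 ^ suc k)))))))
  where
  Zf : ℕ → ℕ → List ℕ
  Zf u v = zipWith _+_ (bits k u ++ 0 ∷ []) (bits (suc k) v)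

A-fillings : ∀ m → A-Fillings m
A-fillings zero zero zero _ _ = refl
A-fillings zero zero (suc zero) _ _ = refl
A-fillings zero zero (suc (suc j')) _ (s≤s (s≤s ()))
A-fillings zero (suc j) j' (s≤s ()) _
A-fillings (suc zero) zero zero _ _ = refl
A-fillings (suc zero) zero (suc zero) _ _ = refl
A-fillings (suc zero) zero (suc (suc zero)) _ _ = refl
A-fillings (suc zero) zero (suc (suc (suc zero))) _ _ = refl
A-fillings (suc zero) (suc zero) zero _ _ = refl
A-fillings (suc zero) (suc zero) (suc zero) _ _ = refl
A-fillings (suc zero) (suc zero) (suc (suc zero)) _ _ = refl
A-fillings (suc zero) (suc zero) (suc (suc (suc zero))) _ _ = refl
A-fillings (suc zero) j (suc (suc (suc (suc j')))) _ (s≤s (s≤s (s≤s (s≤s ()))))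
A-fillings (suc zero) (suc (suc j)) j' (s≤s (s≤s ())) _
A-fillings (suc (suc k)) j j' hj hj' = dec-elim (j <? 2 ^ suc k)
  (λ a → dec-elim (j' <? 2 ^ suc (suc k))
     (λ b → trans (A-ll k j j' a b) (trans (A-fillings-padded k (A-fillings k) j j' a b) (trans (sym (fillingsFrom-0 (Zg j j')))
              (cong fillings (cong₂ (λ u v → zipWith _+_ (u ++ 0 ∷ []) v) (sym (bits-suc-< (suc k) j a)) (sym (bits-suc-< (suc (suc k)) j' b)))))))
     (λ b → trans (A-lh k j j' a (≮⇒≥ b)) (trans (A-fillings (suc k) j (j' ∸ 2 ^ suc (suc k)) a (∸2^<2^ (suc (suc k)) j' (≮⇒≥ b) hj')) (trans (sym (fillingsFrom-1 (Zg j (j' ∸ 2 ^ suc (suc k)))))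
              (cong fillings (cong₂ (λ u v → zipWith _+_ (u ++ 0 ∷ []) v) (sym (bits-suc-< (suc k) j a)) (sym (bits-suc-≥ (suc (suc k)) j' (≮⇒≥ b)))))))))
  (λ a → dec-elim (j' <? 2 ^ suc (suc k))
     (λ b → trans (A-hl k j j' (≮⇒≥ a) b) (trans (A-fillings (suc k) (j ∸ 2 ^ suc k) j' (∸2^<2^ (suc k) j (≮⇒≥ a) hj) b) (trans (sym (fillingsFrom-1 (Zg (j ∸ 2 ^ suc k) j')))
              (cong fillings (cong₂ (λ u v → zipWith _+_ (u ++ 0 ∷ []) v) (sym (bits-suc-≥ (suc k) j (≮⇒≥ a))) (sym (bits-suc-< (suc (suc k)) j' b)))))))
     (λ b → trans (A-hh k j j' (≮⇒≥ a) (≮⇒≥ b)) (sym (trans (cong fillings (cong₂ (λ u v → zipWith _+_ (u ++ 0 ∷ []) v) (bits-suc-≥ (suc k) j (≮⇒≥ a)) (bits-suc-≥ (suc (suc k)) j' (≮⇒≥ b)))) (fillingsFrom-≥2 0 (Zg (j ∸ 2 ^ suc k) (j' ∸ 2 ^ suc (suc k))))))))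
  where
  Zg : ℕ → ℕ → List ℕ
  Zg u v = zipWith _+_ (bits (suc k) u ++ 0 ∷ []) (bits (suc (suc k)) v)

C-Fillings : ℕ → Set
C-Fillings k = ∀ j j' → j < 2 ^ k → j' < 2 ^ k → C k j j' ≡ fillings (zipWith _+_ (bits k j) (bits k j'))

C-fillings-padded : ∀ k → C-Fillings k → ∀ j j' → j < 2 ^ suc k → j' < 2 ^ suc k →
  C k j j' ≡ fillings (occupyHead (zipWith _+_ (bits (suc k) j) (bits (suc k) j')))
C-fillings-padded k ih j j' hj hj' = dec-elim (j <? 2 ^ k)
  (λ a → dec-elim (j' <? 2 ^ k)
     (λ b → trans (ih j j' a b) (trans (sym (fillingsFrom-1 (Zf j j'))) (cong (λ z → fillings (occupyHead z)) (sym (cong₂ (zipWith _+_) (bits-suc-< k j a) (bits-suc-< k j' b))))))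
     (λ b → trans (C-beyondCols k j j' (≮⇒≥ b)) (sym (trans (cong (λ z → fillings (occupyHead z)) (cong₂ (zipWith _+_) (bits-suc-< k j a) (bits-suc-≥ k j' (≮⇒≥ b)))) (fillingsFrom-≥2 0 (Zf j (j' ∸ 2 ^ k)))))))
  (λ a → trans (C-beyondRows k j j' (≮⇒≥ a)) (sym (dec-elim (j' <? 2 ^ k)
     (λ b → trans (cong (λ z → fillings (occupyHead z)) (cong₂ (zipWith _+_) (bits-suc-≥ k j (≮⇒≥ a)) (bits-suc-< k j' b))) (fillingsFrom-≥2 0 (Zf (j ∸ 2 ^ k) j')))
     (λ b → trans (cong (λ z → fillings (occupyHead z)) (cong₂ (zipWith _+_) (bits-suc-≥ k j (≮⇒≥ a)) (bits-suc-≥ k j' (≮⇒≥ b)))) (fillingsFrom-≥2 1 (Zf (j ∸ 2 ^ k) (j' ∸ 2 ^ k)))))))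
  where
  Zf : ℕ → ℕ → List ℕ
  Zf u v = zipWith _+_ (bits k u) (bits k v)

C-fillings : ∀ k → C-Fillings k
C-fillings zero zero zero _ _ = refl
C-fillings zero (suc j) j' (s≤s ()) _
C-fillings zero zero (suc j') _ (s≤s ())
C-fillings (suc zero) zero zero _ _ = refl
C-fillings (suc zero) zero (suc zero) _ _ = refl
C-fillings (suc zero) (suc zero) zero _ _ = refl
C-fillings (suc zero) (suc zero) (suc zero) _ _ = refl
C-fillings (suc zero) (suc (suc j)) j' (s≤s (s≤s ())) _
C-fillings (suc zero) j (suc (suc j')) _ (s≤s (s≤s ()))
C-fillings (suc (suc k)) j j' hj hj' = dec-elim (j <? 2 ^ suc k)
  (λ a → dec-elim (j' <? 2 ^ suc k)
     (λ b → trans (C-ll k j j' a b) (trans (C-fillings-padded k (C-fillings k) j j' a b) (trans (sym (fillingsFrom-0 (Zg j j')))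
              (cong fillings (cong₂ (λ u v → zipWith _+_ u v) (sym (bits-suc-< (suc k) j a)) (sym (bits-suc-< (suc k) j' b)))))))
     (λ b → trans (C-lh k j j' a (≮⇒≥ b)) (trans (C-fillings (suc k) j (j' ∸ 2 ^ suc k) a (∸2^<2^ (suc k) j' (≮⇒≥ b) hj')) (trans (sym (fillingsFrom-1 (Zg j (j' ∸ 2 ^ suc k))))
              (cong fillings (cong₂ (λ u v → zipWith _+_ u v) (sym (bits-suc-< (suc k) j a)) (sym (bits-suc-≥ (suc k) j' (≮⇒≥ b)))))))))
  (λ a → dec-elim (j' <? 2 ^ suc k)
     (λ b → trans (C-hl k j j' (≮⇒≥ a) b) (trans (C-fillings (suc k) (j ∸ 2 ^ suc k) j' (∸2^<2^ (suc k) j (≮⇒≥ a) hj) b) (trans (sym (fillingsFrom-1 (Zg (j ∸ 2 ^ suc k) j')))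
              (cong fillings (cong₂ (λ u v → zipWith _+_ u v) (sym (bits-suc-≥ (suc k) j (≮⇒≥ a))) (sym (bits-suc-< (suc k) j' b)))))))
     (λ b → trans (C-hh k j j' (≮⇒≥ a) (≮⇒≥ b)) (sym (trans (cong fillings (cong₂ (λ u v → zipWith _+_ u v) (bits-suc-≥ (suc k) j (≮⇒≥ a)) (bits-suc-≥ (suc k) j' (≮⇒≥ b)))) (fillingsFrom-≥2 0 (Zg (j ∸ 2 ^ suc k) (j' ∸ 2 ^ suc k)))))))
  where
  Zg : ℕ → ℕ → List ℕ
  Zg u v = zipWith _+_ (bits (suc k) u) (bits (suc k) v)

L-fillings : ∀ m j j' → j < 2 ^ m → j' < 2 ^ suc (suc m) →
  L (suc (suc m)) j j' ≡ fillings (zipWith _+_ (0 ∷ (bits m j ++ 0 ∷ [])) (bits (suc (suc m)) j'))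
L-fillings m j j' hj hj' = dec-elim (j' <? 2 ^ suc m)
  (λ b → trans (L-leftBlock b) (trans (left m j j' hj b) (trans (sym (fillingsFrom-0 (Zf j'))) (cong fillings (cong (zipWith _+_ (0 ∷ (bits m j ++ 0 ∷ []))) (sym (bits-suc-< (suc m) j' b)))))))
  (λ b → trans (L-rightBlock (≮⇒≥ b)) (trans (A-fillings m j (j' ∸ 2 ^ suc m) hj (∸2^<2^ (suc m) j' (≮⇒≥ b) hj')) (trans (sym (fillingsFrom-1 (Zf (j' ∸ 2 ^ suc m)))) (cong fillings (cong (zipWith _+_ (0 ∷ (bits m j ++ 0 ∷ []))) (sym (bits-suc-≥ (suc m) j' (≮⇒≥ b))))))))
  where
  Zf : ℕ → List ℕ
  Zf v = zipWith _+_ (bits m j ++ 0 ∷ []) (bits (suc m) v)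
  L-leftBlock : j' < 2 ^ suc m → L (suc (suc m)) j j' ≡ Lleft m j j'
  L-leftBlock b rewrite <ᵇ-true b = refl
  L-rightBlock : 2 ^ suc m ≤ j' → L (suc (suc m)) j j' ≡ A (suc m) j (j' ∸ 2 ^ suc m)
  L-rightBlock b rewrite <ᵇ-false b = refl
  left : ∀ m j j' → j < 2 ^ m → j' < 2 ^ suc m → Lleft m j j' ≡ fillings (occupyHead (zipWith _+_ (bits m j ++ 0 ∷ []) (bits (suc m) j')))
  left zero zero zero _ _ = refl
  left zero zero (suc zero) _ _ = refl
  left zero zero (suc (suc j')) _ (s≤s (s≤s ()))
  left zero (suc j) j' (s≤s ()) _
  left (suc m') j j' a b = A-fillings-padded m' (A-fillings m') j j' a b


-- Dominoes in one row

range : ℕ → ℕ → List ℕ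
range s zero = []
range s (suc w) = s ∷ range (suc s) w

∈-range⁻ : ∀ {s w x} → x ∈ range s w → s ≤ x × x < s + w
∈-range⁻ {s} {suc w} (here refl) = ≤-refl , subst (s <_) (sym (+-suc s w)) (s≤s (m≤m+n s w))
∈-range⁻ {s} {suc w} {x} (there m) with ∈-range⁻ {suc s} {w} m
... | a , b = ≤-trans (n≤1+n s) a , subst (x <_) (sym (+-suc s w)) b

∈-range⁺ : ∀ {s w x} → s ≤ x → x < s + w → x ∈ range s w
∈-range⁺ {s} {zero} {x} a b = ⊥-elim (<-irrefl refl (≤-trans b (≤-trans (≤-reflexive (+-identityʳ s)) a)))
∈-range⁺ {s} {suc w} {x} a b with s ≟ x
... | yes refl = here refl
... | no ne = there (∈-range⁺ (≤∧≢⇒< a ne) (subst (x <_) (+-suc s w) b))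

Unique-range : ∀ s w → Unique (range s w)
Unique-range s zero = []
Unique-range s (suc w) = All.tabulate (λ m e → <⇒≢ (proj₁ (∈-range⁻ m)) e) ∷ Unique-range (suc s) w

length-range : ∀ s w → length (range s w) ≡ w
length-range s zero = refl
length-range s (suc w) = cong suc (length-range (suc s) w)

range-+ : ∀ o a b → range o (a + b) ≡ range o a ++ range (o + a) b
range-+ o zero b = cong (λ z → range z b) (sym (+-identityʳ o))
range-+ o (suc a) b = cong (o ∷_) (trans (range-+ (suc o) a b) (cong (λ z → range (suc o) a ++ range z b) (sym (+-suc o a))))

map-cong-∈ : {X Y : Set} (xs : List X) {f g : X → Y} → (∀ x → x ∈ xs → f x ≡ g x) → map f xs ≡ map g xs
map-cong-∈ xs h = map-cong-local (All.tabulate (λ {x} m → h x m))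

map-range-zero : ∀ (f : ℕ → ℕ) o a → (∀ x → o ≤ x → x < o + a → f x ≡ 0) → map f (range o a) ≡ replicate a 0
map-range-zero f o zero h = refl
map-range-zero f o (suc a) h =
  cong₂ _∷_ (h o ≤-refl (subst (o <_) (sym (+-suc o a)) (s≤s (m≤m+n o a))))
            (map-range-zero f (suc o) a (λ x le lt → h x (≤-trans (n≤1+n o) le) (subst (x <_) (sym (+-suc o a)) lt)))

horizontal : ℕ → ℕ → Domino
horizontal y x = x , y , true

vertical : ℕ → ℕ → Domino
vertical y x = x , y , false

coverCount : List Domino → ℕ × ℕ → ℕ
coverCount T c = count (λ d → covers d c) T

coverCount-zero : ∀ S c → (∀ d → d ∈ S → covers d c ≡ false) → coverCount S c ≡ 0
coverCount-zero S c = count-zero (λ d → covers d c) S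

covers-horizontal-otherRow : ∀ x₀ y₀ x y → y₀ ≢ y → covers (horizontal y₀ x₀) (x , y) ≡ false
covers-horizontal-otherRow x₀ y₀ x y ne rewrite ≡ᵇ-false ne | ∧-zeroʳ (x₀ ≡ᵇ x) | ∧-zeroʳ (suc x₀ ≡ᵇ x) = refl

covers-vertical-otherRow : ∀ x₀ y₀ x y → y₀ ≢ y → suc y₀ ≢ y → covers (vertical y₀ x₀) (x , y) ≡ false
covers-vertical-otherRow x₀ y₀ x y ne₁ ne₂ rewrite ≡ᵇ-false ne₁ | ≡ᵇ-false ne₂ | ∧-zeroʳ (x₀ ≡ᵇ x) = refl

covers-horizontal : ∀ x₀ y x → covers (horizontal y x₀) (x , y) ≡ ((x₀ ≡ᵇ x) ∨ (suc x₀ ≡ᵇ x))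
covers-horizontal x₀ y x rewrite ≡ᵇ-refl y | ∧-identityʳ (x₀ ≡ᵇ x) | ∧-identityʳ (suc x₀ ≡ᵇ x) with x₀ ≡ᵇ x
... | true = refl
... | false = refl

covers-vertical : ∀ x₀ y₀ x y → (y ≡ y₀ ⊎ y ≡ suc y₀) → covers (vertical y₀ x₀) (x , y) ≡ (x₀ ≡ᵇ x)
covers-vertical x₀ y₀ x .y₀ (inj₁ refl) rewrite ≡ᵇ-refl y₀ | ∧-identityʳ (x₀ ≡ᵇ x) | ≡ᵇ-false {suc y₀} {y₀} (λ e → <-irrefl (sym e) (n<1+n y₀)) with x₀ ≡ᵇ x
... | true = refl
... | false = refl
covers-vertical x₀ y₀ x .(suc y₀) (inj₂ refl) rewrite ≡ᵇ-false {y₀} {suc y₀} (λ e → <-irrefl e (n<1+n y₀)) | ≡ᵇ-refl y₀ | ∧-zeroʳ (x₀ ≡ᵇ x) | ∧-identityʳ (x₀ ≡ᵇ x) with x₀ ≡ᵇ x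
... | true = refl
... | false = refl

covers-horizontal-elsewhere : ∀ x₀ y x → x₀ ≢ x → suc x₀ ≢ x → covers (horizontal y x₀) (x , y) ≡ false
covers-horizontal-elsewhere x₀ y x ne₁ ne₂ rewrite covers-horizontal x₀ y x | ≡ᵇ-false ne₁ | ≡ᵇ-false ne₂ = refl

covers-horizontal-left : ∀ o y → covers (horizontal y o) (o , y) ≡ true
covers-horizontal-left o y rewrite covers-horizontal o y o | ≡ᵇ-refl o = refl

covers-horizontal-right : ∀ o y → covers (horizontal y o) (suc o , y) ≡ true
covers-horizontal-right o y rewrite covers-horizontal o y (suc o) | ≡ᵇ-refl o = ∨-zeroʳ _

coverCount-left-of : ∀ y o L S x → (∀ d → d ∈ S → d ∈ map (horizontal y) (range o L)) → x < o → coverCount S (x , y) ≡ 0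
coverCount-left-of y o L S x h x<o = coverCount-zero S (x , y) (λ d m → left d (h d m))
  where
  left : ∀ d → d ∈ map (horizontal y) (range o L) → covers d (x , y) ≡ false
  left d m with ∈-map⁻ (horizontal y) m
  ... | x₀ , m₀ , refl = covers-horizontal-elsewhere x₀ y x (λ e → <-irrefl (sym e) x<x₀) (λ e → <-irrefl (sym e) (<-trans x<x₀ (n<1+n x₀)))
    where
    x<x₀ : x < x₀
    x<x₀ = <-≤-trans x<o (proj₁ (∈-range⁻ m₀))

exactlyOnce : (ℕ → ℕ) → ℕ → List ℕ → List Domino → Bool
exactlyOnce h y xs S = and (map (λ x → (h x + coverCount S (x , y)) ≡ᵇ 1) xs)

-- Decide whether the leftmost possible domino is present: if it is, cell o must be free and
-- cell o + 1 becomes occupied; if not, cell o must already be occupied.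
horizontal-fillings : ∀ y L o (h : ℕ → ℕ) →
  sumMap (λ S → ind (exactlyOnce h y (range o L) S)) (subsets (map (horizontal y) (range o (L ∸ 1))))
  ≡ fillings (map h (range o L))
horizontal-fillings y zero o h = refl
horizontal-fillings y (suc zero) o h =
  trans (+-identityʳ _) (cong ind (trans (∧-identityʳ _) (cong (_≡ᵇ 1) (+-identityʳ (h o)))))
horizontal-fillings y (suc (suc L)) o h =
  begin
    sumMap F (subsets (horizontal y o ∷ rest))
  ≡⟨ sumMap-subsets-∷ F (horizontal y o) rest ⟩
    sumMap (λ S → F (horizontal y o ∷ S)) (subsets rest) + sumMap F (subsets rest)
  ≡⟨ cong₂ _+_ (sumMap-cong (subsets rest) (λ S m → present S (∈-subsets⇒⊆ rest m)))
               (sumMap-cong (subsets rest) (λ S m → absent S (∈-subsets⇒⊆ rest m))) ⟩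
    sumMap (λ S → free * F+ S) (subsets rest) + sumMap (λ S → occupied * F- S) (subsets rest)
  ≡⟨ cong₂ _+_ (sumMap-*ˡ free F+ (subsets rest)) (sumMap-*ˡ occupied F- (subsets rest)) ⟩
    free * sumMap F+ (subsets rest) + occupied * sumMap F- (subsets rest)
  ≡⟨ cong₂ (λ a b → free * a + occupied * b)
           (trans (horizontal-fillings y (suc L) (suc o) h+) fillings-h+) (horizontal-fillings y (suc L) (suc o) h) ⟩
    free * fillingsFrom (suc (h (suc o))) hs + occupied * fillingsFrom (h (suc o)) hs
  ≡⟨ +-comm (free * fillingsFrom (suc (h (suc o))) hs) (occupied * fillingsFrom (h (suc o)) hs) ⟩
    fillings (map h (range o (suc (suc L))))
  ∎
  where
  rest : List Domino
  rest = map (horizontal y) (range (suc o) L)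
  hs : List ℕ
  hs = map h (range (suc (suc o)) L)
  free occupied : ℕ
  free = ind (h o ≡ᵇ 0)
  occupied = ind (h o ≡ᵇ 1)
  h+ : ℕ → ℕ
  h+ x = h x + ind (suc o ≡ᵇ x)
  F F- F+ : List Domino → ℕ
  F S = ind (exactlyOnce h y (range o (suc (suc L))) S)
  F- S = ind (exactlyOnce h y (range (suc o) (suc L)) S)
  F+ S = ind (exactlyOnce h+ y (range (suc o) (suc L)) S)
  absent : ∀ S → (∀ {d} → d ∈ S → d ∈ rest) → F S ≡ occupied * F- S
  absent S hs =
    trans (cong (λ c → ind (((h o + c) ≡ᵇ 1) ∧ R)) (coverCount-left-of y (suc o) L S o (λ _ → hs) (n<1+n o)))
    (trans (cong (λ z → ind ((z ≡ᵇ 1) ∧ R)) (+-identityʳ (h o))) (ind-∧ (h o ≡ᵇ 1) R))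
    where
    R : Bool
    R = exactlyOnce h y (range (suc o) (suc L)) S
  present : ∀ S → (∀ {d} → d ∈ S → d ∈ rest) → F (horizontal y o ∷ S) ≡ free * F+ S
  present S hs = trans (cong ind (cong₂ _∧_ first (cong and (cong₂ _∷_ second others)))) (ind-∧ (h o ≡ᵇ 0) _)
    where
    S∌o : coverCount S (o , y) ≡ 0
    S∌o = coverCount-left-of y (suc o) L S o (λ _ → hs) (n<1+n o)
    first : ((h o + coverCount (horizontal y o ∷ S) (o , y)) ≡ᵇ 1) ≡ (h o ≡ᵇ 0)
    first rewrite covers-horizontal-left o y | S∌o | +-suc (h o) 0 | +-identityʳ (h o) = refl
    second : ((h (suc o) + coverCount (horizontal y o ∷ S) (suc o , y)) ≡ᵇ 1) ≡ ((h+ (suc o) + coverCount S (suc o , y)) ≡ᵇ 1)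
    second rewrite covers-horizontal-right o y | ≡ᵇ-refl o = cong (_≡ᵇ 1) (sym (+-assoc (h (suc o)) 1 _))
    others : map (λ x → (h x + coverCount (horizontal y o ∷ S) (x , y)) ≡ᵇ 1) (range (suc (suc o)) L)
           ≡ map (λ x → (h+ x + coverCount S (x , y)) ≡ᵇ 1) (range (suc (suc o)) L)
    others = map-cong-∈ (range (suc (suc o)) L) (λ x m → beyond x (proj₁ (∈-range⁻ m)))
      where
      beyond : ∀ x → suc (suc o) ≤ x → ((h x + coverCount (horizontal y o ∷ S) (x , y)) ≡ᵇ 1) ≡ ((h+ x + coverCount S (x , y)) ≡ᵇ 1)
      beyond x lt rewrite covers-horizontal-elsewhere o y x (λ e → <-irrefl e (<-trans (n<1+n o) lt)) (λ e → <-irrefl e lt)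
                        | ≡ᵇ-false {suc o} {x} (λ e → <-irrefl e lt) | +-identityʳ (h x) = refl
  fillings-h+ : fillings (map h+ (range (suc o) (suc L))) ≡ fillingsFrom (suc (h (suc o))) hs
  fillings-h+ =
    cong₂ fillingsFrom (trans (cong (λ b → h (suc o) + ind b) (≡ᵇ-refl o)) (+-comm (h (suc o)) 1))
      (map-cong-∈ (range (suc (suc o)) L)
        (λ x m → trans (cong (λ b → h x + ind b) (≡ᵇ-false {suc o} {x} (λ e → <-irrefl e (proj₁ (∈-range⁻ m))))) (+-identityʳ (h x))))

select-vertical-∷ : ∀ y₀ s w j → select (map (vertical y₀) (range s (suc w))) j ≡
  (if j <ᵇ 2 ^ w then select (map (vertical y₀) (range (suc s) w)) j
   else vertical y₀ s ∷ select (map (vertical y₀) (range (suc s) w)) (j ∸ 2 ^ w))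
select-vertical-∷ y₀ s w j rewrite length-map (vertical y₀) (range (suc s) w) | length-range (suc s) w = refl

module _ (y₀ yr : ℕ) (yr-touches : yr ≡ y₀ ⊎ yr ≡ suc y₀) where

  coverCount-vertical-outside : ∀ s w j x → (x < s ⊎ s + w ≤ x) →
    coverCount (select (map (vertical y₀) (range s w)) j) (x , yr) ≡ 0
  coverCount-vertical-outside s w j x outside =
    coverCount-zero _ (x , yr) (λ d m → missed d (select-⊆ (map (vertical y₀) (range s w)) j m))
    where
    missed : ∀ d → d ∈ map (vertical y₀) (range s w) → covers d (x , yr) ≡ false
    missed d m with ∈-map⁻ (vertical y₀) m
    ... | x₀ , m₀ , refl = trans (covers-vertical x₀ y₀ x yr yr-touches) (≡ᵇ-false (x₀≢x outside))
      where
      x₀≢x : (x < s ⊎ s + w ≤ x) → x₀ ≢ x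
      x₀≢x (inj₁ lt) refl = <-irrefl refl (<-≤-trans lt (proj₁ (∈-range⁻ m₀)))
      x₀≢x (inj₂ ge) refl = <-irrefl refl (<-≤-trans (proj₂ (∈-range⁻ m₀)) ge)

  occupancy-vertical-segment : ∀ w s j →
    map (λ x → coverCount (select (map (vertical y₀) (range s w)) j) (x , yr)) (range s w) ≡ bits w j
  occupancy-vertical-segment zero s j = refl
  occupancy-vertical-segment (suc w) s j = dec-elim (j <? 2 ^ w)
    (λ a → trans (cong (λ D → map (λ x → coverCount D (x , yr)) (range s (suc w)))
                       (trans (select-vertical-∷ y₀ s w j) (cong (λ b → if b then rest j else vertical y₀ s ∷ rest (j ∸ 2 ^ w)) (<ᵇ-true a))))
           (trans (cong₂ _∷_ (coverCount-vertical-outside (suc s) w j s (inj₁ (n<1+n s))) (occupancy-vertical-segment w (suc s) j))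
                  (sym (bits-suc-< w j a))))
    (λ a → trans (cong (λ D → map (λ x → coverCount D (x , yr)) (range s (suc w)))
                       (trans (select-vertical-∷ y₀ s w j) (cong (λ b → if b then rest j else vertical y₀ s ∷ rest (j ∸ 2 ^ w)) (<ᵇ-false (≮⇒≥ a)))))
           (trans (cong₂ _∷_ (head-covered (j ∸ 2 ^ w)) (trans (tail-unchanged (j ∸ 2 ^ w)) (occupancy-vertical-segment w (suc s) (j ∸ 2 ^ w))))
                  (sym (bits-suc-≥ w j (≮⇒≥ a)))))
    where
    rest : ℕ → List Domino
    rest k = select (map (vertical y₀) (range (suc s) w)) k
    head-covered : ∀ k → coverCount (vertical y₀ s ∷ rest k) (s , yr) ≡ 1
    head-covered k rewrite covers-vertical s y₀ s yr yr-touches | ≡ᵇ-refl s =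
      cong suc (coverCount-vertical-outside (suc s) w k s (inj₁ (n<1+n s)))
    tail-unchanged : ∀ k → map (λ x → coverCount (vertical y₀ s ∷ rest k) (x , yr)) (range (suc s) w)
                         ≡ map (λ x → coverCount (rest k) (x , yr)) (range (suc s) w)
    tail-unchanged k = map-cong-∈ (range (suc s) w) (λ x m → beyond x (proj₁ (∈-range⁻ m)))
      where
      beyond : ∀ x → suc s ≤ x → coverCount (vertical y₀ s ∷ rest k) (x , yr) ≡ coverCount (rest k) (x , yr)
      beyond x lt rewrite covers-vertical s y₀ x yr yr-touches | ≡ᵇ-false {s} {x} (λ e → <-irrefl e lt) = refl

  occupancy-vertical : ∀ o a s w b L j → o + a ≡ s → a + (w + b) ≡ L →
    map (λ x → coverCount (select (map (vertical y₀) (range s w)) j) (x , yr)) (range o L)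
    ≡ replicate a 0 ++ (bits w j ++ replicate b 0)
  occupancy-vertical o a .(o + a) w b .(a + (w + b)) j refl refl =
    trans (cong (map f) (trans (range-+ o a (w + b)) (cong (range o a ++_) (range-+ (o + a) w b))))
    (trans (map-++ f (range o a) _)
    (cong₂ _++_ (map-range-zero f o a (λ x _ lt → coverCount-vertical-outside (o + a) w j x (inj₁ lt)))
       (trans (map-++ f (range (o + a) w) _)
         (cong₂ _++_ (occupancy-vertical-segment w (o + a) j)
           (map-range-zero f (o + a + w) b (λ x le _ → coverCount-vertical-outside (o + a) w j x (inj₂ le)))))))
    where
    f : ℕ → ℕ
    f x = coverCount (select (map (vertical y₀) (range (o + a) w)) j) (x , yr)

map-+≡zipWith : ∀ (f g : ℕ → ℕ) xs → map (λ x → f x + g x) xs ≡ zipWith _+_ (map f xs) (map g xs)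
map-+≡zipWith f g [] = refl
map-+≡zipWith f g (x ∷ xs) = cong (f x + g x ∷_) (map-+≡zipWith f g xs)

occupancy-empty : ∀ o L y → map (λ x → coverCount [] (x , y)) (range o L) ≡ replicate L 0
occupancy-empty o L y = map-range-zero _ o L (λ _ _ _ → refl)

replicate-suc-suc : ∀ m → replicate (suc (suc m)) 0 ≡ 0 ∷ (bits m 0 ++ 0 ∷ [])
replicate-suc-suc m = cong (0 ∷_) (trans (replicate-∷ʳ m) (cong (_++ 0 ∷ []) (sym (bits-zero m))))
  where
  replicate-∷ʳ : ∀ m → replicate (suc m) 0 ≡ replicate m 0 ++ 0 ∷ []
  replicate-∷ʳ zero = refl
  replicate-∷ʳ (suc m) = cong (0 ∷_) (replicate-∷ʳ m)

∸≡∸suc+1 : ∀ n y → y < n → n ∸ y ≡ (n ∸ suc y) + 1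
∸≡∸suc+1 (suc n) zero _ = +-comm 1 n
∸≡∸suc+1 (suc n) (suc y) (s≤s lt) = ∸≡∸suc+1 n y lt

<∸1⇒suc< : ∀ {a x} l → a ≤ x → x < a + (l ∸ 1) → suc x < a + l
<∸1⇒suc< {a} zero a≤x lt = ⊥-elim (<-irrefl refl (≤-trans (≤-trans lt (≤-reflexive (+-identityʳ a))) a≤x))
<∸1⇒suc< {a} {x} (suc l) _ lt = subst (suc x <_) (sym (+-suc a l)) (s≤s lt)

suc<⇒<∸1 : ∀ {a x} l → a ≤ x → suc x < a + l → x < a + (l ∸ 1)
suc<⇒<∸1 {a} {x} zero a≤x lt = ⊥-elim (<-irrefl refl (≤-trans (≤-trans lt (≤-reflexive (+-identityʳ a))) (≤-trans a≤x (n≤1+n x))))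
suc<⇒<∸1 {a} {x} (suc l) _ lt = ≤-pred (subst (suc x <_) (+-suc a l) lt)

Unique-concatMap : {X : Set} (key : X → ℕ) (f : ℕ → List X) (xs : List ℕ) → Unique xs →
  (∀ i → Unique (f i)) → (∀ i {z} → z ∈ f i → key z ≡ i) → Unique (concatMap f xs)
Unique-concatMap key f [] u uf hkey = []
Unique-concatMap key f (x ∷ xs) (px ∷ u) uf hkey = ++⁺ (uf x) (Unique-concatMap key f xs u uf hkey) disjoint
  where
  disjoint : ∀ {v} → ¬ (v ∈ f x × v ∈ concatMap f xs)
  disjoint (m₁ , m₂) with find (∈-concatMap⁻ f {xs = xs} m₂)
  ... | i , mi , mv = All.lookup px mi (trans (sym (hkey x m₁)) (hkey i mv))

row : Domino → ℕ
row (x , y , b) = y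

column : Domino → ℕ
column (x , y , b) = x

Unique-candidates : ∀ p q n → Unique (candidates p q n)
Unique-candidates p q n =
  Unique-concatMap column _ (upTo (p + 2 * n)) (upTo⁺ _)
    (λ x → Unique-concatMap row _ (upTo (2 * n + q)) (upTo⁺ _) (λ y → ((λ ()) ∷ []) ∷ [] ∷ []) (inRow x))
    inColumn
  where
  inRow : ∀ x i {z} → z ∈ (x , i , true) ∷ (x , i , false) ∷ [] → row z ≡ i
  inRow x i (here refl) = refl
  inRow x i (there (here refl)) = refl
  inColumn : ∀ i {z} → z ∈ _ → column z ≡ i
  inColumn i m with find (∈-concatMap⁻ (λ y → (i , y , true) ∷ (i , y , false) ∷ []) {xs = upTo (2 * n + q)} m)
  ... | y , _ , here refl = refl
  ... | y , _ , there (here refl) = refl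

∈-candidates : ∀ p q n x y b → x < p + 2 * n → y < 2 * n + q → (x , y , b) ∈ candidates p q n
∈-candidates p q n x y b hx hy =
  ∈-concatMap⁺ _ (lose (∈-upTo⁺ hx) (∈-concatMap⁺ (λ y → (x , y , true) ∷ (x , y , false) ∷ []) (lose (∈-upTo⁺ hy) (orientation b))))
  where
  orientation : ∀ b → (x , y , b) ∈ (x , y , true) ∷ (x , y , false) ∷ []
  orientation true = here refl
  orientation false = there (here refl)

∈-cellsBox : ∀ p q n x y → x < p + 2 * n → y < 2 * n + q → (x , y) ∈ cellsBox p q n
∈-cellsBox p q n x y hx hy =
  ∈-concatMap⁺ (λ x → map (λ y → x , y) (upTo (2 * n + q))) (lose (∈-upTo⁺ hx) (∈-map⁺ (λ y → x , y) (∈-upTo⁺ hy)))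

module Diamond (p q n : ℕ) where

  height : ℕ
  height = 2 * n + q

  excess : ℕ → ℕ
  excess y = halfExcess q n y

  rowStart : ℕ → ℕ
  rowStart y = n ∸ excess y

  rowLength : ℕ → ℕ
  rowLength y = p + 2 * excess y

  width : ℕ
  width = p + 2 * n

  inside : Domino → Bool
  inside d = inReg p q n (cell₁ d) ∧ inReg p q n (cell₂ d)

  horizontals : ℕ → List Domino
  horizontals y = map (horizontal y) (range (rowStart y) (rowLength y ∸ 1))

  sharedExcess : ℕ → ℕ
  sharedExcess y = excess y ⊓ excess (suc y)

  -- A vertical domino from row y to row y + 1 lies in the columns common to both rows.
  boundaryWidth : ℕ → ℕ
  boundaryWidth y = if suc y <ᵇ height then p + 2 * sharedExcess y else 0

  verticals : ℕ → List Domino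
  verticals y = map (vertical y) (range (n ∸ sharedExcess y) (boundaryWidth y))

  rowsFrom : ℕ → ℕ → List Domino
  rowsFrom y zero = []
  rowsFrom y (suc k) = horizontals y ++ (verticals y ++ rowsFrom (suc y) k)

  height≡n+[n+q] : height ≡ n + (n + q)
  height≡n+[n+q] = e n q
    where
    e : ∀ n q → 2 * n + q ≡ n + (n + q)
    e = solve-∀

  height≡n+q+n : height ≡ n + q + n
  height≡n+q+n = trans height≡n+[n+q] (+-comm n (n + q))

  height∸[n+q]≡n : height ∸ (n + q) ≡ n
  height∸[n+q]≡n = trans (cong (_∸ (n + q)) height≡n+q+n) (m+n∸m≡n (n + q) n)

  n+q≤height : n + q ≤ height
  n+q≤height = ≤-trans (m≤m+n (n + q) n) (≤-reflexive (sym height≡n+q+n))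

  n+p+n≡p+2n : n + p + n ≡ p + 2 * n
  n+p+n≡p+2n = e n p
    where
    e : ∀ n p → n + p + n ≡ p + 2 * n
    e = solve-∀

  excess-widening : ∀ y → y < n → excess y ≡ suc y
  excess-widening y y<n rewrite <ᵇ-true y<n = refl

  excess-middle : ∀ y → n ≤ y → y < n + q → excess y ≡ n
  excess-middle y n≤y y<nq rewrite <ᵇ-false n≤y | <ᵇ-true y<nq = refl

  excess-narrowing : ∀ y → n + q ≤ y → excess y ≡ height ∸ y
  excess-narrowing y nq≤y rewrite <ᵇ-false (≤-trans (m≤m+n n q) nq≤y) | <ᵇ-false nq≤y = refl

  excess≤n : ∀ y → excess y ≤ n
  excess≤n y with y <ᵇ n in e₁
  ... | true = <ᵇ-true⁻ e₁
  ... | false with y <ᵇ n + q in e₂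
  ... | true = ≤-refl
  ... | false = narrowing (<ᵇ-false⁻ e₂)
    where
    narrowing : n + q ≤ y → height ∸ y ≤ n
    narrowing h = ≤-trans (∸-monoʳ-≤ height h) (≤-reflexive height∸[n+q]≡n)

  start+length : ∀ m → m ≤ n → n ∸ m + (p + 2 * m) ≡ n + p + m
  start+length m h = trans (e (n ∸ m) m p) (cong (λ z → z + p + m) (m∸n+n≡m h))
    where
    e : ∀ a m p → a + (p + 2 * m) ≡ a + m + p + m
    e = solve-∀

  rowStart+rowLength : ∀ y → rowStart y + rowLength y ≡ n + p + excess y
  rowStart+rowLength y = start+length (excess y) (excess≤n y)

  InRegion : ℕ → ℕ → Set
  InRegion x y = y < height × rowStart y ≤ x × x < n + p + excess y

  inRegion⇒InRegion : ∀ x y → inRegion p q n x y ≡ true → InRegion x y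
  inRegion⇒InRegion x y e with ∧-true⁻ {y <ᵇ height} e
  ... | e1 , e2 with ∧-true⁻ {rowStart y ≤ᵇ x} e2
  ... | e3 , e4 = <ᵇ-true⁻ e1 , ≤ᵇ⇒≤ (rowStart y) x (≡true⇒T e3) , subst (x <_) (rowStart+rowLength y) (<ᵇ-true⁻ e4)

  InRegion⇒inRegion : ∀ x y → InRegion x y → inRegion p q n x y ≡ true
  InRegion⇒inRegion x y (a , b , c) = ∧-true (<ᵇ-true a) (∧-true (≤ᵇ-true b) (<ᵇ-true (subst (x <_) (sym (rowStart+rowLength y)) c)))

  horizontal-inside : ∀ x y → y < height → x ∈ range (rowStart y) (rowLength y ∸ 1) → inside (x , y , true) ≡ true
  horizontal-inside x y yH m with ∈-range⁻ m
  ... | a , b = ∧-true (InRegion⇒inRegion x y (yH , a , subst (x <_) (rowStart+rowLength y) (<-trans (n<1+n x) (<∸1⇒suc< (rowLength y) a b))))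
                    (InRegion⇒inRegion (suc x) y (yH , ≤-trans a (n≤1+n x) , subst (suc x <_) (rowStart+rowLength y) (<∸1⇒suc< (rowLength y) a b)))

  inside-horizontal : ∀ x y → inside (x , y , true) ≡ true → y < height × x ∈ range (rowStart y) (rowLength y ∸ 1)
  inside-horizontal x y e with ∧-true⁻ {inRegion p q n x y} e
  ... | e1 , e2 with inRegion⇒InRegion x y e1 | inRegion⇒InRegion (suc x) y e2
  ... | yH , a , _ | _ , _ , c = yH , ∈-range⁺ a (suc<⇒<∸1 (rowLength y) a (subst (suc x <_) (sym (rowStart+rowLength y)) c))

  ⊓-start : ∀ a b x → (n ∸ a ≤ x × n ∸ b ≤ x) → n ∸ (a ⊓ b) ≤ x
  ⊓-start a b x (h1 , h2) with ≤-total a b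
  ... | inj₁ a≤b rewrite m≤n⇒m⊓n≡m a≤b = h1
  ... | inj₂ b≤a rewrite m≥n⇒m⊓n≡n b≤a = h2

  ⊓-end : ∀ a b x → (x < n + p + a × x < n + p + b) → x < n + p + (a ⊓ b)
  ⊓-end a b x (h1 , h2) with ≤-total a b
  ... | inj₁ a≤b rewrite m≤n⇒m⊓n≡m a≤b = h1
  ... | inj₂ b≤a rewrite m≥n⇒m⊓n≡n b≤a = h2

  start-⊓ : ∀ a b x → n ∸ (a ⊓ b) ≤ x → (n ∸ a ≤ x × n ∸ b ≤ x)
  start-⊓ a b x h = ≤-trans (∸-monoʳ-≤ n (m⊓n≤m a b)) h , ≤-trans (∸-monoʳ-≤ n (m⊓n≤n a b)) h

  end-⊓ : ∀ a b x → x < n + p + (a ⊓ b) → (x < n + p + a × x < n + p + b)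
  end-⊓ a b x h = <-≤-trans h (+-monoʳ-≤ (n + p) (m⊓n≤m a b)) , <-≤-trans h (+-monoʳ-≤ (n + p) (m⊓n≤n a b))

  sharedExcess≤n : ∀ y → sharedExcess y ≤ n
  sharedExcess≤n y = ≤-trans (m⊓n≤m (excess y) (excess (suc y))) (excess≤n y)

  boundaryWidth-interior : ∀ y → suc y < height → boundaryWidth y ≡ p + 2 * sharedExcess y
  boundaryWidth-interior y h rewrite <ᵇ-true h = refl

  boundaryWidth-top : ∀ y → height ≤ suc y → boundaryWidth y ≡ 0
  boundaryWidth-top y h rewrite <ᵇ-false h = refl

  vertical-inside : ∀ x y → x ∈ range (n ∸ sharedExcess y) (boundaryWidth y) → inside (x , y , false) ≡ true
  vertical-inside x y m with suc y <? height
  ... | yes h with ∈-range⁻ (subst (λ w → x ∈ range (n ∸ sharedExcess y) w) (boundaryWidth-interior y h) m)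
  ... | a , b with start-⊓ (excess y) (excess (suc y)) x a | end-⊓ (excess y) (excess (suc y)) x (subst (x <_) (start+length (sharedExcess y) (sharedExcess≤n y)) b)
  ... | a1 , a2 | b1 , b2 = ∧-true (InRegion⇒inRegion x y (<-trans (n<1+n y) h , a1 , b1)) (InRegion⇒inRegion x (suc y) (h , a2 , b2))
  vertical-inside x y m | no ¬h with subst (λ w → x ∈ range (n ∸ sharedExcess y) w) (boundaryWidth-top y (≮⇒≥ ¬h)) m
  ... | ()

  inside-vertical : ∀ x y → inside (x , y , false) ≡ true → suc y < height × x ∈ range (n ∸ sharedExcess y) (boundaryWidth y)
  inside-vertical x y e with ∧-true⁻ {inRegion p q n x y} e
  ... | e1 , e2 with inRegion⇒InRegion x y e1 | inRegion⇒InRegion x (suc y) e2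
  ... | _ , a1 , b1 | yH , a2 , b2 rewrite boundaryWidth-interior y yH =
    yH , ∈-range⁺ (⊓-start (excess y) (excess (suc y)) x (a1 , a2)) (subst (x <_) (sym (start+length (sharedExcess y) (sharedExcess≤n y))) (⊓-end (excess y) (excess (suc y)) x (b1 , b2)))

  inside⇒inBox : ∀ x y b → inside (x , y , b) ≡ true → x < p + 2 * n × y < height
  inside⇒inBox x y b e with inRegion⇒InRegion x y (proj₁ (∧-true⁻ {inRegion p q n x y} e))
  ... | yH , _ , c = <-≤-trans c (≤-trans (+-monoʳ-≤ (n + p) (excess≤n y)) (≤-reflexive n+p+n≡p+2n)) , yH

  ∈-horizontals⁻ : ∀ y {d} → d ∈ horizontals y → ∃ λ x → x ∈ range (rowStart y) (rowLength y ∸ 1) × d ≡ (x , y , true)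
  ∈-horizontals⁻ y m = ∈-map⁻ (horizontal y) m

  ∈-verticals⁻ : ∀ y {d} → d ∈ verticals y → ∃ λ x → x ∈ range (n ∸ sharedExcess y) (boundaryWidth y) × d ≡ (x , y , false)
  ∈-verticals⁻ y m = ∈-map⁻ (vertical y) m

  rowsFrom-row≥ : ∀ y k {d} → d ∈ rowsFrom y k → y ≤ row d
  rowsFrom-row≥ y (suc k) m with ∈-++⁻ (horizontals y) m
  ... | inj₁ m1 with ∈-horizontals⁻ y m1
  ... | x , _ , refl = ≤-refl
  rowsFrom-row≥ y (suc k) m | inj₂ m2 with ∈-++⁻ (verticals y) m2
  ... | inj₁ m1 with ∈-verticals⁻ y m1
  ... | x , _ , refl = ≤-refl
  rowsFrom-row≥ y (suc k) m | inj₂ m2 | inj₂ m3 = ≤-trans (n≤1+n y) (rowsFrom-row≥ (suc y) k m3)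

  rowsFrom-inside : ∀ y k {d} → d ∈ rowsFrom y k → y + k ≤ height → inside d ≡ true
  rowsFrom-inside y (suc k) m h with ∈-++⁻ (horizontals y) m
  ... | inj₁ m1 with ∈-horizontals⁻ y m1
  ... | x , mx , refl = horizontal-inside x y (<-≤-trans (subst (y <_) (sym (+-suc y k)) (s≤s (m≤m+n y k))) h) mx
  rowsFrom-inside y (suc k) m h | inj₂ m2 with ∈-++⁻ (verticals y) m2
  ... | inj₁ m1 with ∈-verticals⁻ y m1
  ... | x , mx , refl = vertical-inside x y mx
  rowsFrom-inside y (suc k) m h | inj₂ m2 | inj₂ m3 = rowsFrom-inside (suc y) k m3 (≤-trans (≤-reflexive (sym (+-suc y k))) h)

  ∈-rowsFrom⁺ : ∀ y k {d} → y ≤ row d → row d < y + k → d ∈ horizontals (row d) ++ verticals (row d) → d ∈ rowsFrom y k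
  ∈-rowsFrom⁺ y zero {d} h1 h2 m = ⊥-elim (<-irrefl refl (<-≤-trans h2 (≤-trans (≤-reflexive (+-identityʳ y)) h1)))
  ∈-rowsFrom⁺ y (suc k) {d} h1 h2 m with y ≟ row d
  ... | yes refl with ∈-++⁻ (horizontals y) m
  ... | inj₁ m1 = ∈-++⁺ˡ m1
  ... | inj₂ m2 = ∈-++⁺ʳ (horizontals y) (∈-++⁺ˡ m2)
  ∈-rowsFrom⁺ y (suc k) {d} h1 h2 m | no ne = ∈-++⁺ʳ (horizontals y) (∈-++⁺ʳ (verticals y) (∈-rowsFrom⁺ (suc y) k (≤∧≢⇒< h1 ne) (subst (row d <_) (+-suc y k) h2) m))

  inside⇒∈-rowsFrom : ∀ {d} → inside d ≡ true → d ∈ rowsFrom 0 height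
  inside⇒∈-rowsFrom {x , y , true} e with inside-horizontal x y e
  ... | yH , mx = ∈-rowsFrom⁺ 0 height z≤n yH (∈-++⁺ˡ (∈-map⁺ (horizontal y) mx))
  inside⇒∈-rowsFrom {x , y , false} e with inside-vertical x y e
  ... | yH , mx = ∈-rowsFrom⁺ 0 height z≤n (<-trans (n<1+n y) yH) (∈-++⁺ʳ (horizontals y) (∈-map⁺ (vertical y) mx))

  Unique-rowsFrom : ∀ y k → Unique (rowsFrom y k)
  Unique-rowsFrom y zero = []
  Unique-rowsFrom y (suc k) = ++⁺ uH (++⁺ uV (Unique-rowsFrom (suc y) k) dis2) dis1
    where
    uH : Unique (horizontals y)
    uH = map⁺ (λ e → cong column e) (Unique-range _ _)
    uV : Unique (verticals y)
    uV = map⁺ (λ e → cong column e) (Unique-range _ _)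
    dis2 : ∀ {v} → ¬ (v ∈ verticals y × v ∈ rowsFrom (suc y) k)
    dis2 (m1 , m2) with ∈-verticals⁻ y m1
    ... | x , _ , refl = <-irrefl refl (rowsFrom-row≥ (suc y) k m2)
    dis1 : ∀ {v} → ¬ (v ∈ horizontals y × v ∈ verticals y ++ rowsFrom (suc y) k)
    dis1 (m1 , m2) with ∈-horizontals⁻ y m1
    ... | x , _ , refl with ∈-++⁻ (verticals y) m2
    ... | inj₂ m3 = <-irrefl refl (rowsFrom-row≥ (suc y) k m3)
    ... | inj₁ m3 with ∈-verticals⁻ y m3
    ... | _ , _ , ()

  coveredOnceWith : (ℕ × ℕ → ℕ) → List Domino → Bool
  coveredOnceWith f T = and (map (λ c → if inReg p q n c then (coverCount T c + f c) ≡ᵇ 1 else true) (cellsBox p q n))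

  tilesWith : (ℕ × ℕ → ℕ) → List Domino → Bool
  tilesWith f T = and (map inside T) ∧ coveredOnceWith f T

  isTiling-↭ : ∀ {S S'} → S ↭ S' → ind (isTiling p q n S) ≡ ind (isTiling p q n S')
  isTiling-↭ {S} {S'} pr = cong ind (cong₂ _∧_ (and-map-↭ inside pr)
    (cong and (map-cong (λ c → cong (λ k → if inReg p q n c then k ≡ᵇ 1 else true) (count-↭ (λ d → covers d c) pr)) (cellsBox p q n))))

  isTiling≡tilesWith : ∀ S → isTiling p q n S ≡ tilesWith (λ _ → 0) S
  isTiling≡tilesWith S = cong (and (map inside S) ∧_)
    (cong and (map-cong (λ c → cong (λ k → if inReg p q n c then k ≡ᵇ 1 else true) (sym (+-identityʳ (coverCount S c)))) (cellsBox p q n)))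

  α≡sumOverRows : α p q n ≡ sumMap (λ T → ind (tilesWith (λ _ → 0) T)) (subsets (rowsFrom 0 height))
  α≡sumOverRows =
    trans (count≡sumMap (isTiling p q n) (subsets (candidates p q n)))
    (trans (sumMap-subsets-filter inside (candidates p q n) (λ S → ind (isTiling p q n S))
              (λ S z m e → ind-false (∧-falseˡ (and-map-false inside m e))))
    (trans (sumMap-subsets-↭ (Unique-⊆-⊇⇒↭ (filter⁺ (λ z → T? (inside z)) {xs = candidates p q n} (Unique-candidates p q n)) (Unique-rowsFrom 0 height) to from)
              (λ S → ind (isTiling p q n S)) (λ S → ind (isTiling p q n S)) isTiling-↭)
    (sumMap-cong (subsets (rowsFrom 0 height)) (λ S _ → cong ind (isTiling≡tilesWith S)))))
    where
    to : ∀ {z} → z ∈ filter (λ z → T? (inside z)) (candidates p q n) → z ∈ rowsFrom 0 height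
    to m = inside⇒∈-rowsFrom (T⇒≡true (proj₂ (∈-filter⁻ {P = λ z → T (inside z)} (λ z → T? (inside z)) {xs = candidates p q n} m)))
    from : ∀ {z} → z ∈ rowsFrom 0 height → z ∈ filter (λ z → T? (inside z)) (candidates p q n)
    from {x , y , b} m with rowsFrom-inside 0 height m ≤-refl
    ... | e with inside⇒inBox x y b e
    ... | hx , hy = ∈-filter⁺ {P = λ z → T (inside z)} (λ z → T? (inside z)) (∈-candidates p q n x y b hx hy) (≡true⇒T e)

  narrowing-from : ∀ y k → y + k ≡ height → k ≤ n → n + q ≤ y
  narrowing-from y k yk k≤n = +-cancelʳ-≤ k (n + q) y (≤-trans (+-monoʳ-≤ (n + q) k≤n) (≤-reflexive (trans (sym height≡n+q+n) (sym yk))))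

  excess-top : ∀ y k → y + k ≡ height → k ≤ n → excess y ≡ k
  excess-top y k yk k≤n = trans (excess-narrowing y (narrowing-from y k yk k≤n)) (trans (cong (_∸ y) (sym yk)) (m+n∸m≡n y k))

  excess-middle′ : ∀ y → n ≤ y → y ≤ n + q → excess y ≡ n
  excess-middle′ y h1 h2 with y <? n + q
  ... | yes lt = excess-middle y h1 lt
  ... | no ¬lt with ≤-antisym h2 (≮⇒≥ ¬lt)
  ... | refl = trans (excess-narrowing (n + q) ≤-refl) height∸[n+q]≡n

  excess-before-middle : ∀ y → n ≤ suc y → suc y ≤ n + q → excess y ≡ n
  excess-before-middle y h1 h2 with n ≤? y
  ... | yes le = excess-middle′ y le (≤-trans (n≤1+n y) h2)
  ... | no ¬le = trans (excess-widening y (≰⇒> ¬le)) (≤-antisym (≰⇒> ¬le) h1)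

  excess-below-top : ∀ y k → suc y + k ≡ height → k ≤ n → k ≤ excess y
  excess-below-top y k e k≤n with k <? n
  ... | yes k<n = ≤-trans (n≤1+n k) (≤-reflexive (sym (excess-top y (suc k) (trans (+-suc y k) e) k<n)))
  ... | no k≮n with ≤-antisym k≤n (≮⇒≥ k≮n)
  ... | refl = subst (n ≤_) (sym (excess-before-middle y (≤-trans (m≤m+n n q) (≤-reflexive (sym sy≡n+q))) (≤-reflexive sy≡n+q))) ≤-refl
    where
    sy≡n+q : suc y ≡ n + q
    sy≡n+q = +-cancelʳ-≡ n (suc y) (n + q) (trans e height≡n+q+n)

  sharedExcess-widening : ∀ y → y < n → sharedExcess y ≡ suc y
  sharedExcess-widening y y<n = trans (cong (_⊓ excess (suc y)) (excess-widening y y<n)) (m≤n⇒m⊓n≡m ge)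
    where
    ge : suc y ≤ excess (suc y)
    ge with suc y <? n
    ... | yes lt = ≤-trans (n≤1+n (suc y)) (≤-reflexive (sym (excess-widening (suc y) lt)))
    ... | no ¬lt = subst (suc y ≤_) (sym (excess-middle′ (suc y) (≮⇒≥ ¬lt) (≤-trans y<n (m≤m+n n q)))) y<n

  boundaryWidth-widening : ∀ k → k < n → boundaryWidth k ≡ p + 2 * suc k
  boundaryWidth-widening k k<n = trans (boundaryWidth-interior k skH) (cong (λ m → p + 2 * m) (trans (cong (_⊓ excess (suc k)) (excess-widening k k<n)) (m≤n⇒m⊓n≡m ge)))
    where
    lemma : ∀ n → 0 < n → suc n ≤ 2 * n + q
    lemma (suc n') _ = ≤-trans (m≤m+n (suc (suc n')) (n' + q)) (≤-reflexive (e n' q))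
      where
      e : ∀ n' q → suc (suc n') + (n' + q) ≡ 2 * suc n' + q
      e = solve-∀
    skH : suc k < height
    skH = ≤-trans (s≤s k<n) (lemma n (≤-trans (s≤s z≤n) k<n))
    ge : suc k ≤ excess (suc k)
    ge with suc k <? n
    ... | yes lt = ≤-trans (n≤1+n (suc k)) (≤-reflexive (sym (excess-widening (suc k) lt)))
    ... | no ¬lt = subst (suc k ≤_) (sym (excess-middle′ (suc k) (≮⇒≥ ¬lt) (≤-trans k<n (m≤m+n n q)))) k<n

  boundaryWidth-middle : ∀ y → n ≤ suc y → suc y ≤ n + q → suc y < height → boundaryWidth y ≡ width
  boundaryWidth-middle y n≤ ≤n+q lt =
    trans (boundaryWidth-interior y lt)
          (cong (λ m → p + 2 * m) (trans (cong₂ _⊓_ (excess-before-middle y n≤ ≤n+q) (excess-middle′ (suc y) n≤ ≤n+q)) (⊓-idem n)))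

  boundaryWidth-below-top : ∀ y k → suc y + k ≡ height → k ≤ n → suc y < height → boundaryWidth y ≡ p + 2 * k
  boundaryWidth-below-top y k e k≤n lt =
    trans (boundaryWidth-interior y lt)
          (cong (λ m → p + 2 * m) (trans (cong (excess y ⊓_) (excess-top (suc y) k e k≤n)) (m≥n⇒m⊓n≡n (excess-below-top y k e k≤n))))


  incoming : ℕ → List Domino
  incoming zero = []
  incoming (suc y) = verticals y

  incomingWidth : ℕ → ℕ
  incomingWidth zero = 0
  incomingWidth (suc y) = boundaryWidth y

  length-verticals : ∀ y → length (verticals y) ≡ boundaryWidth y
  length-verticals y = trans (length-map _ (range (n ∸ sharedExcess y) (boundaryWidth y))) (length-range _ _)

  rowExact : ℕ → (ℕ × ℕ → ℕ) → Bool
  rowExact y f = and (map (λ x → f (x , y) ≡ᵇ 1) (range (rowStart y) (rowLength y)))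

  rowsBelowExact : ℕ → (ℕ × ℕ → ℕ) → Bool
  rowsBelowExact zero f = true
  rowsBelowExact (suc y) f = rowsBelowExact y f ∧ rowExact y f

  -- The states of the boundary below row y and above it are the numbers j and j' whose binary
  -- digits select the vertical dominoes crossing it.
  transfer : ℕ → ℕ → ℕ → ℕ
  transfer y j j' =
    fillings (map (λ x → coverCount (select (incoming y) j) (x , y) + coverCount (select (verticals y) j') (x , y))
                  (range (rowStart y) (rowLength y)))

  sumMap-horizontals≡transfer : ∀ y j j' →
    sumMap (λ S → ind (rowExact y (λ c → coverCount (select (incoming y) j) c + coverCount (select (verticals y) j') c + coverCount S c)))
           (subsets (horizontals y))
    ≡ transfer y j j'
  sumMap-horizontals≡transfer y j j' = horizontal-fillings y (rowLength y) (rowStart y) _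

  sweep : ℕ → ℕ → ℕ → ℕ
  sweep zero y j = ind (j ≡ᵇ 0)
  sweep (suc k) y j = sumTo (λ j' → transfer y j j' * sweep k (suc y) j') (2 ^ boundaryWidth y)

  coverCount-horizontals-elsewhere : ∀ y S x y' → (∀ {d} → d ∈ S → d ∈ horizontals y) → y ≢ y' → coverCount S (x , y') ≡ 0
  coverCount-horizontals-elsewhere y S x y' S⊆ ne = coverCount-zero S (x , y') (λ d m → missed (S⊆ m))
    where
    missed : ∀ {d} → d ∈ horizontals y → covers d (x , y') ≡ false
    missed m with ∈-horizontals⁻ y m
    ... | x₀ , _ , refl = covers-horizontal-otherRow x₀ y x y' ne

  coverCount-verticals-elsewhere : ∀ y S x y' → (∀ {d} → d ∈ S → d ∈ verticals y) → y ≢ y' → suc y ≢ y' → coverCount S (x , y') ≡ 0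
  coverCount-verticals-elsewhere y S x y' S⊆ ne₁ ne₂ = coverCount-zero S (x , y') (λ d m → missed (S⊆ m))
    where
    missed : ∀ {d} → d ∈ verticals y → covers d (x , y') ≡ false
    missed m with ∈-verticals⁻ y m
    ... | x₀ , _ , refl = covers-vertical-otherRow x₀ y x y' ne₁ ne₂

  inside-horizontals : ∀ y → y < height → ∀ {d} → d ∈ horizontals y → inside d ≡ true
  inside-horizontals y y<height m with ∈-horizontals⁻ y m
  ... | x , mx , refl = horizontal-inside x y y<height mx

  inside-verticals : ∀ y {d} → d ∈ verticals y → inside d ≡ true
  inside-verticals y m with ∈-verticals⁻ y m
  ... | x , mx , refl = vertical-inside x y mx

  tilesWith-++ : ∀ f U T → (∀ d → d ∈ U → inside d ≡ true) → tilesWith f (U ++ T) ≡ tilesWith (λ c → f c + coverCount U c) T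
  tilesWith-++ f U T U-inside = cong₂ _∧_
    (trans (cong and (map-++ inside U T)) (trans (and-++ (map inside U) (map inside T))
           (cong (_∧ and (map inside T)) (and-map-true inside U U-inside))))
    (cong and (map-cong (λ c → cong (λ k → if inReg p q n c then k ≡ᵇ 1 else true)
        (trans (cong (_+ f c) (count-++ _ U T)) (rotate (coverCount U c) (coverCount T c) (f c)))) (cellsBox p q n)))
    where
    rotate : ∀ a b c → a + b + c ≡ b + (c + a)
    rotate = solve-∀

  rowsBelowExact-cong : ∀ y f g → (∀ x y' → y' < y → f (x , y') ≡ g (x , y')) → rowsBelowExact y f ≡ rowsBelowExact y g
  rowsBelowExact-cong zero f g h = refl
  rowsBelowExact-cong (suc y) f g h = cong₂ _∧_ (rowsBelowExact-cong y f g (λ x y' lt → h x y' (<-trans lt (n<1+n y))))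
    (cong and (map-cong (λ x → cong (_≡ᵇ 1) (h x y (n<1+n y))) (range (rowStart y) (rowLength y))))

  rowExact-cong : ∀ y f g → (∀ x → f (x , y) ≡ g (x , y)) → rowExact y f ≡ rowExact y g
  rowExact-cong y f g h = cong and (map-cong (λ x → cong (_≡ᵇ 1) (h x)) (range (rowStart y) (rowLength y)))

  rowsBelowExact-row : ∀ y f S V → (∀ {d} → d ∈ S → d ∈ horizontals y) → (∀ {d} → d ∈ V → d ∈ verticals y) →
    rowsBelowExact y (λ c → f c + coverCount S c + coverCount V c) ≡ rowsBelowExact y f
  rowsBelowExact-row y f S V S⊆ V⊆ = rowsBelowExact-cong y _ f (λ x y' lt →
    trans (cong₂ (λ a b → f (x , y') + a + b)
                 (coverCount-horizontals-elsewhere y S x y' S⊆ (λ eq → <-irrefl (sym eq) lt))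
                 (coverCount-verticals-elsewhere y V x y' V⊆ (λ eq → <-irrefl (sym eq) lt) (λ eq → <-irrefl (sym eq) (<-trans lt (n<1+n y)))))
          (trans (+-identityʳ _) (+-identityʳ _)))

  rowsBelowExact⇒ : ∀ y f → rowsBelowExact y f ≡ true → ∀ y' → y' < y → rowExact y' f ≡ true
  rowsBelowExact⇒ (suc y) f e y' lt with ∧-true⁻ {rowsBelowExact y f} e
  ... | e₁ , e₂ with y' ≟ y
  ... | yes refl = e₂
  ... | no ne = rowsBelowExact⇒ y f e₁ y' (≤∧≢⇒< (≤-pred lt) ne)

  ⇒rowsBelowExact : ∀ y f → (∀ y' → y' < y → rowExact y' f ≡ true) → rowsBelowExact y f ≡ true
  ⇒rowsBelowExact zero f h = refl
  ⇒rowsBelowExact (suc y) f h rewrite ⇒rowsBelowExact y f (λ y' lt → h y' (<-trans lt (n<1+n y))) | h y (n<1+n y) = refl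

  coveredOnceWith-[] : ∀ f → coveredOnceWith f [] ≡ rowsBelowExact height f
  coveredOnceWith-[] f = bool-ext to from
    where
    to : coveredOnceWith f [] ≡ true → rowsBelowExact height f ≡ true
    to e = ⇒rowsBelowExact height f (λ y' lt → and-map-true _ (range (rowStart y') (rowLength y')) (λ x m → cell y' lt x m))
      where
      cell : ∀ y' → y' < height → ∀ x → x ∈ range (rowStart y') (rowLength y') → (f (x , y') ≡ᵇ 1) ≡ true
      cell y' lt x m with ∈-range⁻ m
      ... | a , b with subst (x <_) (rowStart+rowLength y') b
      ... | b' with and-map-true⁻ _ (cellsBox p q n) e (x , y')
                      (∈-cellsBox p q n x y' (<-≤-trans b' (≤-trans (+-monoʳ-≤ (n + p) (excess≤n y')) (≤-reflexive n+p+n≡p+2n))) lt)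
      ... | r rewrite InRegion⇒inRegion x y' (lt , a , b') = r
    from : rowsBelowExact height f ≡ true → coveredOnceWith f [] ≡ true
    from e = and-map-true _ (cellsBox p q n) cell
      where
      cell : ∀ c → c ∈ cellsBox p q n → (if inReg p q n c then (0 + f c) ≡ᵇ 1 else true) ≡ true
      cell (x , y') m with inRegion p q n x y' in eq
      ... | false = refl
      ... | true with inRegion⇒InRegion x y' eq
      ... | lt , a , b = and-map-true⁻ _ (range (rowStart y') (rowLength y')) (rowsBelowExact⇒ height f e y' lt) x
                           (∈-range⁺ a (subst (x <_) (sym (rowStart+rowLength y')) b))

  incomingWidth-top : ∀ y → height ≤ y → incomingWidth y ≡ 0
  incomingWidth-top zero h = refl
  incomingWidth-top (suc y) h = boundaryWidth-top y h

  coverCount-incoming-above : ∀ y j x y' → suc y ≤ y' → coverCount (select (incoming y) j) (x , y') ≡ 0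
  coverCount-incoming-above zero j x y' h = refl
  coverCount-incoming-above (suc y₀) j x y' h =
    coverCount-verticals-elsewhere y₀ (select (verticals y₀) j) x y' (select-⊆ (verticals y₀) j)
      (λ e → <-irrefl e (≤-trans (n≤1+n _) h)) (λ e → <-irrefl e h)

  -- f is the coverage by the dominoes already chosen below row y; of these, only the vertical
  -- dominoes selected by the incoming state j reach row y or beyond.
  sumOverRows≡sweep : ∀ k y → y + k ≡ height → ∀ (f e : ℕ × ℕ → ℕ) (j : ℕ) → j < 2 ^ incomingWidth y →
    (∀ x y' → y ≤ y' → e (x , y') ≡ 0) → (∀ c → f c ≡ e c + coverCount (select (incoming y) j) c) →
    sumMap (λ T → ind (tilesWith f T)) (subsets (rowsFrom y k)) ≡ ind (rowsBelowExact y f) * sweep k y j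
  sumOverRows≡sweep zero y y+0≡height f e j j<2^w e-above f≡ with trans (sym (+-identityʳ y)) y+0≡height
  ... | refl with subst (j <_) (cong (2 ^_) (incomingWidth-top height ≤-refl)) j<2^w
  ... | s≤s z≤n = trans (+-identityʳ _) (trans (cong ind (coveredOnceWith-[] f)) (sym (*-identityʳ _)))
  sumOverRows≡sweep (suc k) y y+k≡height f e j j<2^w e-above f≡ =
    begin
      sumMap (λ T → ind (tilesWith f T)) (subsets (horizontals y ++ (verticals y ++ rowsFrom (suc y) k)))
    ≡⟨ sumMap-subsets-++ _ (horizontals y) _ ⟩
      sumMap (λ S → sumMap (λ T → ind (tilesWith f (S ++ T))) (subsets (verticals y ++ rowsFrom (suc y) k))) (subsets (horizontals y))
    ≡⟨ sumMap-cong (subsets (horizontals y)) (λ S mS → choose-verticals S (∈-subsets⇒⊆ (horizontals y) mS)) ⟩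
      sumMap (λ S → sumTo (λ j' → below * (rowOK j' S * sweep k (suc y) j')) W) (subsets (horizontals y))
    ≡⟨ sumMap-cong (subsets (horizontals y)) (λ S _ → sumMap-*ˡ below _ (upTo W)) ⟩
      sumMap (λ S → below * sumTo (λ j' → rowOK j' S * sweep k (suc y) j') W) (subsets (horizontals y))
    ≡⟨ sumMap-*ˡ below _ (subsets (horizontals y)) ⟩
      below * sumMap (λ S → sumTo (λ j' → rowOK j' S * sweep k (suc y) j') W) (subsets (horizontals y))
    ≡⟨ cong (below *_) (sumMap-swap _ (subsets (horizontals y)) (upTo W)) ⟩
      below * sumTo (λ j' → sumMap (λ S → rowOK j' S * sweep k (suc y) j') (subsets (horizontals y))) W
    ≡⟨ cong (below *_) (sumTo-cong W (λ j' _ → choose-horizontals j')) ⟩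
      below * sweep (suc k) y j
    ∎
    where
    W below : ℕ
    W = 2 ^ boundaryWidth y
    below = ind (rowsBelowExact y f)
    occupancy : ℕ → ℕ × ℕ → ℕ
    occupancy j' c = coverCount (select (incoming y) j) c + coverCount (select (verticals y) j') c
    rowOK : ℕ → List Domino → ℕ
    rowOK j' S = ind (rowExact y (λ c → occupancy j' c + coverCount S c))

    choose-horizontals : ∀ j' → sumMap (λ S → rowOK j' S * sweep k (suc y) j') (subsets (horizontals y)) ≡ transfer y j j' * sweep k (suc y) j'
    choose-horizontals j' =
      trans (sumMap-cong (subsets (horizontals y)) (λ S _ → *-comm _ (sweep k (suc y) j')))
      (trans (sumMap-*ˡ (sweep k (suc y) j') _ (subsets (horizontals y)))
      (trans (*-comm (sweep k (suc y) j') _)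
             (cong (_* sweep k (suc y) j') (sumMap-horizontals≡transfer y j j'))))

    choose-verticals : ∀ S → (∀ {d} → d ∈ S → d ∈ horizontals y) →
      sumMap (λ T → ind (tilesWith f (S ++ T))) (subsets (verticals y ++ rowsFrom (suc y) k)) ≡
      sumTo (λ j' → below * (rowOK j' S * sweep k (suc y) j')) W
    choose-verticals S S⊆ =
      begin
        sumMap (λ T → ind (tilesWith f (S ++ T))) (subsets (verticals y ++ rowsFrom (suc y) k))
      ≡⟨ sumMap-subsets-++ _ (verticals y) _ ⟩
        sumMap (λ V → sumMap (λ T → ind (tilesWith f (S ++ (V ++ T)))) (subsets (rowsFrom (suc y) k))) (subsets (verticals y))
      ≡⟨ sumMap-subsets≡sumTo-select _ (verticals y) ⟩
        sumTo (λ j' → sumMap (λ T → ind (tilesWith f (S ++ (select (verticals y) j' ++ T)))) (subsets (rowsFrom (suc y) k))) (2 ^ length (verticals y))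
      ≡⟨ cong (λ w → sumTo (λ j' → sumMap (λ T → ind (tilesWith f (S ++ (select (verticals y) j' ++ T)))) (subsets (rowsFrom (suc y) k))) (2 ^ w))
              (length-verticals y) ⟩
        sumTo (λ j' → sumMap (λ T → ind (tilesWith f (S ++ (select (verticals y) j' ++ T)))) (subsets (rowsFrom (suc y) k))) W
      ≡⟨ sumTo-cong W next-row ⟩
        sumTo (λ j' → below * (rowOK j' S * sweep k (suc y) j')) W
      ∎
      where
      next-row : ∀ j' → j' < W →
        sumMap (λ T → ind (tilesWith f (S ++ (select (verticals y) j' ++ T)))) (subsets (rowsFrom (suc y) k)) ≡
        below * (rowOK j' S * sweep k (suc y) j')
      next-row j' j'<W =
        begin
          sumMap (λ T → ind (tilesWith f (S ++ (V ++ T)))) (subsets (rowsFrom (suc y) k))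
        ≡⟨ sumMap-cong (subsets (rowsFrom (suc y) k))
             (λ T _ → cong ind (trans (tilesWith-++ f S (V ++ T) (λ d m → inside-horizontals y y<height (S⊆ m)))
                                      (tilesWith-++ _ V T (λ d m → inside-verticals y (V⊆ m))))) ⟩
          sumMap (λ T → ind (tilesWith f′ T)) (subsets (rowsFrom (suc y) k))
        ≡⟨ sumOverRows≡sweep k (suc y) (trans (sym (+-suc y k)) y+k≡height) f′ e′ j' j'<W e′-above (λ c → cong (λ z → z + coverCount S c + coverCount V c) (f≡ c)) ⟩
          ind (rowsBelowExact y f′ ∧ rowExact y f′) * sweep k (suc y) j'
        ≡⟨ trans (cong (_* sweep k (suc y) j') (ind-∧ (rowsBelowExact y f′) (rowExact y f′))) (*-assoc (ind (rowsBelowExact y f′)) _ _) ⟩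
          ind (rowsBelowExact y f′) * (ind (rowExact y f′) * sweep k (suc y) j')
        ≡⟨ cong₂ (λ a b → ind a * (ind b * sweep k (suc y) j')) (rowsBelowExact-row y f S V S⊆ V⊆) row-y ⟩
          below * (rowOK j' S * sweep k (suc y) j')
        ∎
        where
        V : List Domino
        V = select (verticals y) j'
        V⊆ : ∀ {d} → d ∈ V → d ∈ verticals y
        V⊆ = select-⊆ (verticals y) j'
        y<height : y < height
        y<height = subst (y <_) y+k≡height (subst (y <_) (sym (+-suc y k)) (s≤s (m≤m+n y k)))
        f′ e′ : ℕ × ℕ → ℕ
        f′ c = f c + coverCount S c + coverCount V c
        e′ c = e c + coverCount (select (incoming y) j) c + coverCount S c
        e′-above : ∀ x y' → suc y ≤ y' → e′ (x , y') ≡ 0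
        e′-above x y' h =
          trans (cong₂ (λ a b → a + b + coverCount S (x , y')) (e-above x y' (≤-trans (n≤1+n y) h)) (coverCount-incoming-above y j x y' h))
                (coverCount-horizontals-elsewhere y S x y' S⊆ (λ eq → <-irrefl eq h))
        row-y : rowExact y f′ ≡ rowExact y (λ c → occupancy j' c + coverCount S c)
        row-y = rowExact-cong y f′ (λ c → occupancy j' c + coverCount S c) (λ x →
          trans (cong (λ z → z + coverCount S (x , y) + coverCount V (x , y))
                      (trans (f≡ (x , y)) (cong (_+ coverCount (select (incoming y) j) (x , y)) (e-above x y ≤-refl))))
                (swap (coverCount (select (incoming y) j) (x , y)) (coverCount S (x , y)) (coverCount V (x , y))))
          where
          swap : ∀ a b c → a + b + c ≡ a + c + b
          swap = solve-∀

  size : ℕ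
  size = 2 ^ width

  Cmid Lprod : Mat
  Cmid = C width
  Lprod = prodL p n

  paperMatrix : ℕ → ℕ → ℕ → ℕ
  paperMatrix y j j' = if y <ᵇ n then L (p + 2 * suc y) j j' else (if y <ᵇ n + q then C (p + 2 * n) j j' else L (rowLength y) j' j)

  paperSweep : ℕ → ℕ → ℕ → ℕ
  paperSweep zero y j = ind (j ≡ᵇ 0)
  paperSweep (suc k) y j = sumTo (λ j' → paperMatrix y j j' * paperSweep k (suc y) j') (2 ^ boundaryWidth y)

  paperMatrix-widening : ∀ y j j' → y < n → paperMatrix y j j' ≡ L (p + 2 * suc y) j j'
  paperMatrix-widening y j j' h rewrite <ᵇ-true h = refl

  paperMatrix-middle : ∀ y j j' → n ≤ y → y < n + q → paperMatrix y j j' ≡ C width j j'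
  paperMatrix-middle y j j' h1 h2 rewrite <ᵇ-false h1 | <ᵇ-true h2 = refl

  paperMatrix-narrowing : ∀ y j j' → n + q ≤ y → paperMatrix y j j' ≡ L (rowLength y) j' j
  paperMatrix-narrowing y j j' h rewrite <ᵇ-false (≤-trans (m≤m+n n q) h) | <ᵇ-false h = refl

  ind≡idM : ∀ s → ind (s ≡ᵇ 0) ≡ idM (2 ^ p) 0 s
  ind≡idM zero rewrite <ᵇ-true (m^n>0 2 p) = refl
  ind≡idM (suc s) = refl

  paperSweep-narrowing : ∀ k y → k ≤ n → y + k ≡ height → ∀ s → paperSweep k y s ≡ prodL p k 0 s
  paperSweep-narrowing zero y k≤n yk s = ind≡idM s
  paperSweep-narrowing (suc zero) y k≤n yk s =
    begin
      sumTo (λ j' → paperMatrix y s j' * paperSweep 0 (suc y) j') (2 ^ boundaryWidth y)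
    ≡⟨ cong (λ w → sumTo (λ j' → paperMatrix y s j' * paperSweep 0 (suc y) j') (2 ^ w)) (boundaryWidth-top y (≤-reflexive (trans (sym yk) (+-comm y 1)))) ⟩
      paperMatrix y s 0 * 1 + 0
    ≡⟨ trans (+-identityʳ _) (trans (*-identityʳ _) (paperMatrix-narrowing y s 0 (narrowing-from y 1 yk k≤n))) ⟩
      L (rowLength y) 0 s
    ≡⟨ cong (λ m → L (p + 2 * m) 0 s) (excess-top y 1 yk k≤n) ⟩
      L (p + 2 * 1) 0 s
    ≡⟨ sym (mul-identityˡ (2 ^ p) (L (p + 2 * 1)) 0 s (m^n>0 2 p)) ⟩
      mul (2 ^ p) (idM (2 ^ p)) (L (p + 2 * 1)) 0 s
    ≡⟨ cong (λ d → mul (2 ^ d) (idM (2 ^ p)) (L (p + 2 * 1)) 0 s) (sym (+-identityʳ p)) ⟩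
      prodL p 1 0 s
    ∎
  paperSweep-narrowing (suc (suc k)) y k≤n yk s =
    begin
      sumTo (λ j' → paperMatrix y s j' * paperSweep (suc k) (suc y) j') (2 ^ boundaryWidth y)
    ≡⟨ cong (λ w → sumTo (λ j' → paperMatrix y s j' * paperSweep (suc k) (suc y) j') (2 ^ w)) wvy ⟩
      sumTo (λ j' → paperMatrix y s j' * paperSweep (suc k) (suc y) j') (2 ^ (p + 2 * suc k))
    ≡⟨ sumTo-cong (2 ^ (p + 2 * suc k)) (λ j' _ → trans (cong₂ _*_ (trans (paperMatrix-narrowing y s j' (narrowing-from y (suc (suc k)) yk k≤n)) (cong (λ m → L (p + 2 * m) j' s) (excess-top y (suc (suc k)) yk k≤n))) (paperSweep-narrowing (suc k) (suc y) (≤-trans (n≤1+n _) k≤n) yk' j')) (*-comm (L (p + 2 * suc (suc k)) j' s) (prodL p (suc k) 0 j'))) ⟩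
      prodL p (suc (suc k)) 0 s
    ∎
    where
    yk' : suc y + suc k ≡ height
    yk' = trans (sym (+-suc y (suc k))) yk
    wvy : boundaryWidth y ≡ p + 2 * suc k
    wvy = boundaryWidth-below-top y (suc k) yk' (≤-trans (n≤1+n _) k≤n) (subst (suc y <_) yk' (m<m+n (suc y) (s≤s z≤n)))

  paperSweep-middle : ∀ r y → r ≤ q → y + r ≡ n + q → ∀ s → s < size → paperSweep (n + r) y s ≡ mul size (powM size Cmid r) (tr Lprod) s 0
  paperSweep-middle zero y r≤q yr s s<size =
    trans (cong (λ f → paperSweep f y s) (+-identityʳ n))
    (trans (paperSweep-narrowing n y ≤-refl (trans (cong (_+ n) (trans (sym (+-identityʳ y)) yr)) (sym height≡n+q+n)) s)
    (sym (mul-identityˡ size (tr Lprod) s 0 s<size)))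
  paperSweep-middle (suc r) y r≤q yr s s<size =
    trans (cong (λ f → paperSweep f y s) (+-suc n r)) (body (suc y <? height))
    where
    yr' : suc y + r ≡ n + q
    yr' = trans (sym (+-suc y r)) yr
    ny : n ≤ y
    ny = +-cancelʳ-≤ (suc r) n y (≤-trans (+-monoʳ-≤ n r≤q) (≤-reflexive (sym yr)))
    yq : y < n + q
    yq = subst (y <_) yr (subst (y <_) (sym (+-suc y r)) (s≤s (m≤m+n y r)))
    IH : ∀ j' → j' < size → paperSweep (n + r) (suc y) j' ≡ mul size (powM size Cmid r) (tr Lprod) j' 0
    IH j' lt = paperSweep-middle r (suc y) (≤-trans (n≤1+n r) r≤q) yr' j' lt
    tailM : sumTo (λ j' → Cmid s j' * mul size (powM size Cmid r) (tr Lprod) j' 0) size ≡ mul size (powM size Cmid (suc r)) (tr Lprod) s 0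
    tailM = trans (sym (mul-assoc size size Cmid (powM size Cmid r) (tr Lprod) s 0))
                 (mul-cong size {M = mul size Cmid (powM size Cmid r)} {M' = powM size Cmid (suc r)} {N = tr Lprod} {N' = tr Lprod} s 0
                   (λ t t<size → sym (powM-suc size Cmid r s t s<size t<size)) (λ _ _ → refl))
    body : Dec (suc y < height) → sumTo (λ j' → paperMatrix y s j' * paperSweep (n + r) (suc y) j') (2 ^ boundaryWidth y) ≡ mul size (powM size Cmid (suc r)) (tr Lprod) s 0
    body (yes lt) =
      trans (cong (λ w → sumTo (λ j' → paperMatrix y s j' * paperSweep (n + r) (suc y) j') (2 ^ w))
              (boundaryWidth-middle y (≤-trans ny (n≤1+n y)) yq lt))
      (trans (sumTo-cong size (λ j' lt' → cong₂ _*_ (paperMatrix-middle y s j' ny yq) (IH j' lt'))) tailM)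
    body (no ¬lt) = trans (cong (λ w → sumTo (λ j' → paperMatrix y s j' * paperSweep (n + r) (suc y) j') (2 ^ w)) (boundaryWidth-top y (≮⇒≥ ¬lt)))
      (trans (+-identityʳ _) (trans (cong₂ _*_ (paperMatrix-middle y s 0 ny yq) (no-rows-left 0))
      (trans (*-identityʳ _)
      (trans (sym (sumTo-indicatorʳ (λ j' → Cmid s j') size 0 (m^n>0 2 width)))
      (trans (sumTo-cong size (λ j' lt' → cong (Cmid s j' *_) (trans (sym (no-rows-left j')) (IH j' lt')))) tailM)))))
      where
      nr0 : n + r ≡ 0
      nr0 = n≤0⇒n≡0 (+-cancelʳ-≤ (n + q) (n + r) 0 (≤-trans (≤-reflexive (e1 n q r)) (≤-trans (+-monoˡ-≤ r (≮⇒≥ ¬lt)) (≤-reflexive (trans (e2 y r) yr)))))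
        where
        e1 : ∀ n q r → n + r + (n + q) ≡ 2 * n + q + r
        e1 = solve-∀
        e2 : ∀ y r → suc y + r ≡ y + suc r
        e2 = solve-∀
      no-rows-left : ∀ j' → paperSweep (n + r) (suc y) j' ≡ ind (j' ≡ᵇ 0)
      no-rows-left j' rewrite nr0 = refl

  paperSweep-widening : ∀ k F → k ≤ n → k + F ≡ height → sumTo (λ t → prodL p k 0 t * paperSweep F k t) (2 ^ (p + 2 * k)) ≡ paperSweep height 0 0
  paperSweep-widening zero F k≤n kF rewrite kF =
    trans (cong (λ d → sumTo (λ t → idM (2 ^ p) 0 t * paperSweep height 0 t) (2 ^ d)) (+-identityʳ p))
          (mul-identityˡ (2 ^ p) (λ t _ → paperSweep height 0 t) 0 0 (m^n>0 2 p))
  paperSweep-widening (suc k) zero k≤n kF with +-cancelˡ-≤ (suc k) (suc k) 0 (≤-trans two (≤-reflexive (sym kF)))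
    where
    two : suc k + suc k ≤ height
    two = ≤-trans (+-mono-≤ k≤n k≤n) (≤-trans (m≤m+n (n + n) q) (≤-reflexive (trans (+-assoc n n q) (sym height≡n+[n+q]))))
  ... | ()
  paperSweep-widening (suc k) (suc F) k≤n kF =
    begin
      sumTo (λ t → sumTo (λ u → Pk u * Lk u t) Nₖ * Ph t) Nₖ₊₁
    ≡⟨ sumTo-cong Nₖ₊₁ (λ t _ → sym (sumTo-*ʳ (λ u → Pk u * Lk u t) (Ph t) Nₖ)) ⟩
      sumTo (λ t → sumTo (λ u → Pk u * Lk u t * Ph t) Nₖ) Nₖ₊₁
    ≡⟨ sumTo-swap (λ t u → Pk u * Lk u t * Ph t) Nₖ₊₁ Nₖ ⟩
      sumTo (λ u → sumTo (λ t → Pk u * Lk u t * Ph t) Nₖ₊₁) Nₖ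
    ≡⟨ sumTo-cong Nₖ (λ u _ → trans (sumTo-cong Nₖ₊₁ (λ t _ → *-assoc (Pk u) (Lk u t) (Ph t))) (sumMap-*ˡ (Pk u) (λ t → Lk u t * Ph t) (upTo Nₖ₊₁))) ⟩
      sumTo (λ u → Pk u * sumTo (λ t → Lk u t * Ph t) Nₖ₊₁) Nₖ
    ≡⟨ sumTo-cong Nₖ (λ u _ → cong (Pk u *_) (sym inner)) ⟩
      sumTo (λ u → Pk u * paperSweep (suc (suc F)) k u) Nₖ
    ≡⟨ paperSweep-widening k (suc (suc F)) (≤-trans (n≤1+n k) k≤n) (trans (+-suc k (suc F)) kF) ⟩
      paperSweep height 0 0
    ∎
    where
    Nₖ₊₁ Nₖ : ℕ
    Nₖ₊₁ = 2 ^ (p + 2 * suc k)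
    Nₖ = 2 ^ (p + 2 * k)
    Pk : ℕ → ℕ
    Pk u = prodL p k 0 u
    Lk : ℕ → ℕ → ℕ
    Lk = L (p + 2 * suc k)
    Ph : ℕ → ℕ
    Ph t = paperSweep (suc F) (suc k) t
    inner : ∀ {u} → paperSweep (suc (suc F)) k u ≡ sumTo (λ t → Lk u t * Ph t) Nₖ₊₁
    inner {u} = trans (cong (λ w → sumTo (λ t → paperMatrix k u t * Ph t) (2 ^ w)) (boundaryWidth-widening k k≤n))
                      (sumTo-cong Nₖ₊₁ (λ t _ → cong (_* Ph t) (paperMatrix-widening k u t k≤n)))

  matrixFormula≡paperSweep : matrixFormula p q n ≡ paperSweep height 0 0
  matrixFormula≡paperSweep =
    trans (mul-assoc size size Lprod (powM size Cmid q) (tr Lprod) 0 0)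
    (trans (sumTo-cong size (λ t t<size → cong (Lprod 0 t *_) (sym (paperSweep-middle q n ≤-refl refl t t<size))))
    (paperSweep-widening n (n + q) ≤-refl (sym height≡n+[n+q])))



  incomingOccupancy : ℕ → ℕ → List ℕ
  incomingOccupancy y j = map (λ x → coverCount (select (incoming y) j) (x , y)) (range (rowStart y) (rowLength y))

  outgoingOccupancy : ℕ → ℕ → List ℕ
  outgoingOccupancy y j' = map (λ x → coverCount (select (verticals y) j') (x , y)) (range (rowStart y) (rowLength y))

  transfer-zipWith : ∀ y j j' → transfer y j j' ≡ fillings (zipWith _+_ (incomingOccupancy y j) (outgoingOccupancy y j'))
  transfer-zipWith y j j' = cong fillings (map-+≡zipWith _ _ (range (rowStart y) (rowLength y)))

  incomingOccupancy-bottom : ∀ j → incomingOccupancy 0 j ≡ replicate (rowLength 0) 0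
  incomingOccupancy-bottom j = occupancy-empty (rowStart 0) (rowLength 0) 0

  outgoingOccupancy-top : ∀ y j' → height ≤ suc y → outgoingOccupancy y j' ≡ replicate (rowLength y) 0
  outgoingOccupancy-top y j' top =
    trans (cong (λ w → map (λ x → coverCount (select (map (vertical y) (range (n ∸ sharedExcess y) w)) j') (x , y)) (range (rowStart y) (rowLength y)))
                (boundaryWidth-top y top))
          (occupancy-empty (rowStart y) (rowLength y) y)

  -- On the top row there is no outgoing boundary, so j' = 0 and any state may replace it.
  module _ (y j' : ℕ) (j'<2^w : j' < 2 ^ boundaryWidth y) where

    outgoingState : Dec (suc y < height) → ℕ
    outgoingState (yes _) = j'
    outgoingState (no _) = 0

    j'≡outgoingState : ∀ d → j' ≡ outgoingState d
    j'≡outgoingState (yes _) = refl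
    j'≡outgoingState (no ¬lt) = n<1⇒n≡0 (subst (j' <_) (cong (2 ^_) (boundaryWidth-top y (≮⇒≥ ¬lt))) j'<2^w)

  transfer-widening : ∀ y → y < n → ∀ j j' → j < 2 ^ incomingWidth y → j' < 2 ^ boundaryWidth y → transfer y j j' ≡ paperMatrix y j j'
  transfer-widening y y<n j j' j< j'< =
    begin
      transfer y j j'
    ≡⟨ transfer-zipWith y j j' ⟩
      fillings (zipWith _+_ (incomingOccupancy y j) (outgoingOccupancy y j'))
    ≡⟨ cong₂ (λ u v → fillings (zipWith _+_ u v)) (incoming-bits y y<n j j<) outgoing-bits ⟩
      fillings (zipWith _+_ (0 ∷ (bits (p + 2 * y) j ++ 0 ∷ [])) (bits (rowLength y) j'))
    ≡⟨ cong (λ l → fillings (zipWith _+_ (0 ∷ (bits (p + 2 * y) j ++ 0 ∷ [])) (bits l j'))) rowLength≡ ⟩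
      fillings (zipWith _+_ (0 ∷ (bits (p + 2 * y) j ++ 0 ∷ [])) (bits (2 + (p + 2 * y)) j'))
    ≡⟨ sym (L-fillings (p + 2 * y) j j' (incoming< y y<n j<) (subst (j' <_) (cong (2 ^_) (trans (boundaryWidth-widening y y<n) (two+ p y))) j'<)) ⟩
      L (2 + (p + 2 * y)) j j'
    ≡⟨ trans (cong (λ l → L l j j') (sym (two+ p y))) (sym (paperMatrix-widening y j j' y<n)) ⟩
      paperMatrix y j j'
    ∎
    where
    two+ : ∀ p y → p + 2 * suc y ≡ 2 + (p + 2 * y)
    two+ = solve-∀
    rowLength≡ : rowLength y ≡ 2 + (p + 2 * y)
    rowLength≡ = trans (cong (λ m → p + 2 * m) (excess-widening y y<n)) (two+ p y)
    incoming< : ∀ y → y < n → j < 2 ^ incomingWidth y → j < 2 ^ (p + 2 * y)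
    incoming< zero _ h = <-≤-trans h (m^n>0 2 (p + 2 * 0))
    incoming< (suc y₀) y<n h = subst (j <_) (cong (2 ^_) (boundaryWidth-widening y₀ (<-trans (n<1+n y₀) y<n))) h
    outgoing-bits : outgoingOccupancy y j' ≡ bits (rowLength y) j'
    outgoing-bits =
      trans (occupancy-vertical y y (inj₁ refl) (rowStart y) 0 (n ∸ sharedExcess y) (boundaryWidth y) 0 (rowLength y) j'
               (trans (+-identityʳ _) (cong (n ∸_) (trans (excess-widening y y<n) (sym (sharedExcess-widening y y<n)))))
               (trans (+-identityʳ _) (trans (boundaryWidth-widening y y<n) (cong (λ m → p + 2 * m) (sym (excess-widening y y<n))))))
            (trans (++-identityʳ _) (cong (λ w → bits w j') (trans (boundaryWidth-widening y y<n) (cong (λ m → p + 2 * m) (sym (excess-widening y y<n))))))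
    incoming-bits : ∀ y → y < n → ∀ j → j < 2 ^ incomingWidth y → incomingOccupancy y j ≡ 0 ∷ (bits (p + 2 * y) j ++ 0 ∷ [])
    incoming-bits zero y<n j j< rewrite n<1⇒n≡0 j< =
      trans (incomingOccupancy-bottom j)
            (trans (cong (λ m → replicate (p + 2 * m) 0) (excess-widening 0 y<n)) (trans (cong (λ k → replicate k 0) (two+ p 0)) (replicate-suc-suc (p + 2 * 0))))
    incoming-bits (suc y₀) y<n j j< =
      trans (occupancy-vertical y₀ (suc y₀) (inj₂ refl) (rowStart (suc y₀)) 1 (n ∸ sharedExcess y₀) (boundaryWidth y₀) 1 (rowLength (suc y₀)) j
               (trans (cong (λ m → n ∸ m + 1) (excess-widening (suc y₀) y<n))
                      (trans (sym (∸≡∸suc+1 n (suc y₀) y<n)) (cong (n ∸_) (sym (sharedExcess-widening y₀ y₀<n)))))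
               (trans (cong (λ w → 1 + (w + 1)) (boundaryWidth-widening y₀ y₀<n)) (trans (pad p y₀) (cong (λ m → p + 2 * m) (sym (excess-widening (suc y₀) y<n))))))
            (cong (λ w → 0 ∷ (bits w j ++ 0 ∷ [])) (boundaryWidth-widening y₀ y₀<n))
      where
      y₀<n : y₀ < n
      y₀<n = <-trans (n<1+n y₀) y<n
      pad : ∀ p y₀ → 1 + (p + 2 * suc y₀ + 1) ≡ p + 2 * suc (suc y₀)
      pad = solve-∀

  transfer-middle : ∀ y → n ≤ y → y < n + q → ∀ j j' → j < 2 ^ incomingWidth y → j' < 2 ^ boundaryWidth y → transfer y j j' ≡ paperMatrix y j j'
  transfer-middle y n≤y y<n+q j j' j< j'< =
    begin
      transfer y j j'
    ≡⟨ transfer-zipWith y j j' ⟩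
      fillings (zipWith _+_ (incomingOccupancy y j) (outgoingOccupancy y j'))
    ≡⟨ cong₂ (λ u v → fillings (zipWith _+_ u v)) (incoming-bits y n≤y y<n+q j j<) (outgoing-bits d) ⟩
      fillings (zipWith _+_ (bits width j) (bits width (outgoingState y j' j'< d)))
    ≡⟨ sym (C-fillings width j (outgoingState y j' j'< d) (incoming< y n≤y y<n+q j<) (state< d)) ⟩
      C width j (outgoingState y j' j'< d)
    ≡⟨ trans (cong (C width j) (sym (j'≡outgoingState y j' j'< d))) (sym (paperMatrix-middle y j j' n≤y y<n+q)) ⟩
      paperMatrix y j j'
    ∎
    where
    d : Dec (suc y < height)
    d = suc y <? height
    excess≡n : excess y ≡ n
    excess≡n = excess-middle y n≤y y<n+q
    rowLength≡width : rowLength y ≡ width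
    rowLength≡width = cong (λ m → p + 2 * m) excess≡n
    incoming< : ∀ y → n ≤ y → y < n + q → j < 2 ^ incomingWidth y → j < 2 ^ width
    incoming< zero _ _ h = <-≤-trans h (m^n>0 2 width)
    incoming< (suc y₀) n≤ lt h = subst (j <_) (cong (2 ^_) (boundaryWidth-middle y₀ n≤ (<⇒≤ lt) (<-≤-trans lt n+q≤height))) h
    state< : ∀ d → outgoingState y j' j'< d < 2 ^ width
    state< (yes lt) = subst (j' <_) (cong (2 ^_) (boundaryWidth-middle y (≤-trans n≤y (n≤1+n y)) y<n+q lt)) j'<
    state< (no _) = m^n>0 2 width
    outgoing-bits : ∀ d → outgoingOccupancy y j' ≡ bits width (outgoingState y j' j'< d)
    outgoing-bits (yes lt) =
      trans (occupancy-vertical y y (inj₁ refl) (rowStart y) 0 (n ∸ sharedExcess y) (boundaryWidth y) 0 (rowLength y) j'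
               (trans (+-identityʳ _) (cong (n ∸_) (trans excess≡n (sym shared≡n))))
               (trans (+-identityʳ _) (trans width≡ (sym rowLength≡width))))
            (trans (++-identityʳ _) (cong (λ w → bits w j') width≡))
      where
      width≡ : boundaryWidth y ≡ width
      width≡ = boundaryWidth-middle y (≤-trans n≤y (n≤1+n y)) y<n+q lt
      shared≡n : sharedExcess y ≡ n
      shared≡n = trans (cong₂ _⊓_ excess≡n (excess-middle′ (suc y) (≤-trans n≤y (n≤1+n y)) y<n+q)) (⊓-idem n)
    outgoing-bits (no ¬lt) =
      trans (outgoingOccupancy-top y j' (≮⇒≥ ¬lt)) (trans (cong (λ k → replicate k 0) rowLength≡width) (sym (bits-zero width)))
    incoming-bits : ∀ y → n ≤ y → y < n + q → ∀ j → j < 2 ^ incomingWidth y → incomingOccupancy y j ≡ bits width j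
    incoming-bits zero n≤ lt j j< rewrite n<1⇒n≡0 j< =
      trans (incomingOccupancy-bottom j)
            (trans (cong (λ k → replicate k 0) (cong (λ m → p + 2 * m) (excess-middle 0 n≤ lt))) (sym (bits-zero width)))
    incoming-bits (suc y₀) n≤ lt j j< =
      trans (occupancy-vertical y₀ (suc y₀) (inj₂ refl) (rowStart (suc y₀)) 0 (n ∸ sharedExcess y₀) (boundaryWidth y₀) 0 (rowLength (suc y₀)) j
               (trans (+-identityʳ _) (cong (n ∸_) (trans (excess-middle (suc y₀) n≤ lt) (sym shared≡n))))
               (trans (+-identityʳ _) (trans width≡ (cong (λ m → p + 2 * m) (sym (excess-middle (suc y₀) n≤ lt))))))
            (trans (++-identityʳ _) (cong (λ w → bits w j) width≡))
      where
      shared≡n : sharedExcess y₀ ≡ n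
      shared≡n = trans (cong₂ _⊓_ (excess-before-middle y₀ n≤ (<⇒≤ lt)) (excess-middle (suc y₀) n≤ lt)) (⊓-idem n)
      width≡ : boundaryWidth y₀ ≡ width
      width≡ = boundaryWidth-middle y₀ n≤ (<⇒≤ lt) (<-≤-trans lt n+q≤height)

  transfer-narrowing : ∀ y m → y + suc m ≡ height → suc m ≤ n → ∀ j j' → j < 2 ^ incomingWidth y → j' < 2 ^ boundaryWidth y →
    transfer y j j' ≡ paperMatrix y j j'
  transfer-narrowing y m y+sm≡height sm≤n j j' j< j'< =
    begin
      transfer y j j'
    ≡⟨ transfer-zipWith y j j' ⟩
      fillings (zipWith _+_ (incomingOccupancy y j) (outgoingOccupancy y j'))
    ≡⟨ cong₂ (λ u v → fillings (zipWith _+_ u v)) (incoming-bits y y+sm≡height j<) (outgoing-bits d) ⟩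
      fillings (zipWith _+_ (bits (rowLength y) j) (0 ∷ (bits (p + 2 * m) j'′ ++ 0 ∷ [])))
    ≡⟨ cong (λ l → fillings (zipWith _+_ (bits l j) (0 ∷ (bits (p + 2 * m) j'′ ++ 0 ∷ [])))) rowLength≡ ⟩
      fillings (zipWith _+_ (bits (2 + (p + 2 * m)) j) (0 ∷ (bits (p + 2 * m) j'′ ++ 0 ∷ [])))
    ≡⟨ cong fillings (zipWith-comm _+_ +-comm (bits (2 + (p + 2 * m)) j) _) ⟩
      fillings (zipWith _+_ (0 ∷ (bits (p + 2 * m) j'′ ++ 0 ∷ [])) (bits (2 + (p + 2 * m)) j))
    ≡⟨ sym (L-fillings (p + 2 * m) j'′ j (state< d) (incoming< y y+sm≡height j<)) ⟩
      L (2 + (p + 2 * m)) j'′ j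
    ≡⟨ trans (cong (λ l → L l j'′ j) (sym rowLength≡)) (cong (λ v → L (rowLength y) v j) (sym (j'≡outgoingState y j' j'< d))) ⟩
      L (rowLength y) j' j
    ≡⟨ sym (paperMatrix-narrowing y j j' (narrowing-from y (suc m) y+sm≡height sm≤n)) ⟩
      paperMatrix y j j'
    ∎
    where
    d : Dec (suc y < height)
    d = suc y <? height
    j'′ : ℕ
    j'′ = outgoingState y j' j'< d
    two+ : ∀ p m → p + 2 * suc m ≡ 2 + (p + 2 * m)
    two+ = solve-∀
    excess≡ : excess y ≡ suc m
    excess≡ = excess-top y (suc m) y+sm≡height sm≤n
    rowLength≡ : rowLength y ≡ 2 + (p + 2 * m)
    rowLength≡ = trans (cong (λ k → p + 2 * k) excess≡) (two+ p m)
    not-bottom : ∀ y → y + suc m ≡ height → y ≢ 0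
    not-bottom .0 e refl with +-cancelˡ-≤ (suc m) (suc m) 0 (≤-trans (+-mono-≤ sm≤n sm≤n)
                                 (≤-trans (m≤m+n (n + n) q) (≤-reflexive (trans (+-assoc n n q) (trans (sym height≡n+[n+q]) (trans (sym e) (sym (+-identityʳ (suc m)))))))))
    ... | ()
    width≡ : ∀ y₀ → suc y₀ + suc m ≡ height → boundaryWidth y₀ ≡ p + 2 * suc m
    width≡ y₀ e = boundaryWidth-below-top y₀ (suc m) e sm≤n (subst (suc y₀ <_) e (m<m+n (suc y₀) (s≤s z≤n)))
    incoming< : ∀ y → y + suc m ≡ height → j < 2 ^ incomingWidth y → j < 2 ^ (2 + (p + 2 * m))
    incoming< zero e h = ⊥-elim (not-bottom zero e refl)
    incoming< (suc y₀) e h = subst (j <_) (cong (2 ^_) (trans (width≡ y₀ e) (two+ p m))) h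
    incoming-bits : ∀ y → y + suc m ≡ height → j < 2 ^ incomingWidth y → incomingOccupancy y j ≡ bits (rowLength y) j
    incoming-bits zero e h = ⊥-elim (not-bottom zero e refl)
    incoming-bits (suc y₀) e h =
      trans (occupancy-vertical y₀ (suc y₀) (inj₂ refl) (rowStart (suc y₀)) 0 (n ∸ sharedExcess y₀) (boundaryWidth y₀) 0 (rowLength (suc y₀)) j
               (trans (+-identityʳ _) (cong (n ∸_) (trans (excess-top (suc y₀) (suc m) e sm≤n) (sym shared≡))))
               (trans (+-identityʳ _) (trans (width≡ y₀ e) (cong (λ k → p + 2 * k) (sym (excess-top (suc y₀) (suc m) e sm≤n))))))
            (trans (++-identityʳ _) (cong (λ w → bits w j) (trans (width≡ y₀ e) (cong (λ k → p + 2 * k) (sym (excess-top (suc y₀) (suc m) e sm≤n))))))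
      where
      shared≡ : sharedExcess y₀ ≡ suc m
      shared≡ = trans (cong (excess y₀ ⊓_) (excess-top (suc y₀) (suc m) e sm≤n)) (m≥n⇒m⊓n≡n (excess-below-top y₀ (suc m) e sm≤n))
    sy+m≡height : suc y + m ≡ height
    sy+m≡height = trans (sym (+-suc y m)) y+sm≡height
    shared≡m : sharedExcess y ≡ m
    shared≡m = trans (cong₂ _⊓_ excess≡ (excess-top (suc y) m sy+m≡height (≤-trans (n≤1+n m) sm≤n))) (m≥n⇒m⊓n≡n (n≤1+n m))
    outgoing-width : suc y < height → boundaryWidth y ≡ p + 2 * m
    outgoing-width lt = trans (boundaryWidth-interior y lt) (cong (λ k → p + 2 * k) shared≡m)
    state< : ∀ d → outgoingState y j' j'< d < 2 ^ (p + 2 * m)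
    state< (yes lt) = subst (j' <_) (cong (2 ^_) (outgoing-width lt)) j'<
    state< (no _) = m^n>0 2 (p + 2 * m)
    outgoing-bits : ∀ d → outgoingOccupancy y j' ≡ 0 ∷ (bits (p + 2 * m) (outgoingState y j' j'< d) ++ 0 ∷ [])
    outgoing-bits (yes lt) =
      trans (occupancy-vertical y y (inj₁ refl) (rowStart y) 1 (n ∸ sharedExcess y) (boundaryWidth y) 1 (rowLength y) j'
               (trans (cong (λ k → n ∸ k + 1) excess≡) (trans (sym (∸≡∸suc+1 n m sm≤n)) (cong (n ∸_) (sym shared≡m))))
               (trans (cong (λ w → 1 + (w + 1)) (outgoing-width lt)) (trans (pad p m) (cong (λ k → p + 2 * k) (sym excess≡)))))
            (cong (λ w → 0 ∷ (bits w j' ++ 0 ∷ [])) (outgoing-width lt))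
      where
      pad : ∀ p m → 1 + (p + 2 * m + 1) ≡ p + 2 * suc m
      pad = solve-∀
    outgoing-bits (no ¬lt) =
      trans (outgoingOccupancy-top y j' (≮⇒≥ ¬lt)) (trans (cong (λ k → replicate k 0) rowLength≡) (replicate-suc-suc (p + 2 * m)))

  transfer≡paperMatrix : ∀ y → y < height → ∀ j j' → j < 2 ^ incomingWidth y → j' < 2 ^ boundaryWidth y → transfer y j j' ≡ paperMatrix y j j'
  transfer≡paperMatrix y y<height j j' j< j'< with y <? n | y <? n + q
  ... | yes y<n | _ = transfer-widening y y<n j j' j< j'<
  ... | no y≮n | yes y<n+q = transfer-middle y (≮⇒≥ y≮n) y<n+q j j' j< j'<
  ... | no _ | no y≮n+q = narrowing (height ∸ y) refl
    where
    narrowing : ∀ k → height ∸ y ≡ k → transfer y j j' ≡ paperMatrix y j j'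
    narrowing zero eq = ⊥-elim (<⇒≢ (m<n⇒0<n∸m y<height) (sym eq))
    narrowing (suc m) eq =
      transfer-narrowing y m (trans (cong (y +_) (sym eq)) (m+[n∸m]≡n (<⇒≤ y<height)))
        (subst (_≤ n) eq (≤-trans (∸-monoʳ-≤ height (≮⇒≥ y≮n+q)) (≤-reflexive height∸[n+q]≡n))) j j' j< j'<

  sweep≡paperSweep : ∀ k y → y + k ≡ height → ∀ j → j < 2 ^ incomingWidth y → sweep k y j ≡ paperSweep k y j
  sweep≡paperSweep zero y e j h = refl
  sweep≡paperSweep (suc k) y e j h =
    sumTo-cong (2 ^ boundaryWidth y) (λ j' lt →
      cong₂ _*_ (transfer≡paperMatrix y (subst (y <_) e (m<m+n y (s≤s z≤n))) j j' h lt)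
                (sweep≡paperSweep k (suc y) (trans (sym (+-suc y k)) e) j' lt))

theorem1 : (p q n : ℕ) → α p q n ≡ matrixFormula p q n
theorem1 p q n =
  begin
    α p q n
  ≡⟨ α≡sumOverRows ⟩
    sumMap (λ T → ind (tilesWith (λ _ → 0) T)) (subsets (rowsFrom 0 height))
  ≡⟨ sumOverRows≡sweep height 0 refl (λ _ → 0) (λ _ → 0) 0 (s≤s z≤n) (λ _ _ _ → refl) (λ _ → refl) ⟩
    1 * sweep height 0 0
  ≡⟨ *-identityˡ _ ⟩
    sweep height 0 0
  ≡⟨ sweep≡paperSweep height 0 refl 0 (s≤s z≤n) ⟩
    paperSweep height 0 0
  ≡⟨ sym matrixFormula≡paperSweep ⟩
    matrixFormula p q n
  ∎
  where open Diamond p q n
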